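{- Let $A=(A_1,\ldots,A_m)\in\mathbb{Z}^{n\times m}$ with $\mathrm{rank}(A)=n$. Run the following procedure (Generalized Euclidean Algorithm, basic version) on $A$: 1. Choose $n$ linearly independent columns of $A$ and let $B=(B_1,\ldots,B_n)\in\mathbb{Z}^{n\times n}$ be the matrix they form; let $C$ be the multiset of the remaining $m-n$ columns of $A$. 2. While $C\neq\emptyset$: choose any $c\in C$ and compute the solution $x\in\mathbb{Q}^n$ of $Bx=c$. If $x\in\mathbb{Z}^n$, remove $c$ from $C$. Otherwise choose an index $i$ with $\{x_i\}\neq 0$ (for instance one minimizing $|x_i-\lceil x_i\rfloor|$ among such indices, but any such index is allowed), replace $C$ by $(C\setminus\{c\})\cup\{B_i\}$, and replace the column $B_i$ by $c-\big(\sum_{j\neq i}B_j\lfloor x_j\rfloor + B_i\lceil x_i\rfloor\big)$ (computed with the old $B_i$). 3. Output $B$. Then, for every choice made in the procedure, it terminates and outputs a matrix $B\in\mathbb{Z}^{n\times n}$ with $\mathcal{L}(B)=\mathcal{L}(A)$, i.e. a basis of the lattice $\mathcal{L}(A)$.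
   Context: For a matrix $M$ with columns $M_1,\ldots,M_k\in\mathbb{Z}^n$, $\mathcal{L}(M)=\{\sum_{i=1}^k\lambda_iM_i:\lambda_i\in\mathbb{Z}\}$ is the lattice generated by its columns. For $z\in\mathbb{R}$, $\lfloor z\rfloor$ is the floor, $\{z\}=z-\lfloor z\rfloor\in[0,1)$ is the fractional part, and $\lceil z\rfloor=\lfloor z+1/2\rfloor$ is the nearest integer. Standing assumption of the paper: $\mathrm{rank}(A)=n$. -}

module Defs where

open import Data.Nat as ℕ using (ℕ; zero; suc)
open import Data.Integer as ℤ using (ℤ)
open import Data.Rational as ℚ using (ℚ; 0ℚ; ½)
open import Data.Fin using (Fin; zero; suc; _≟_)
open import Data.Fin.Properties using (any?)
open import Data.List using (List; []; _∷_; _++_; map; filter)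
open import Data.List.Base using ()
open import Data.Product using (Σ; ∃; _×_; _,_)
open import Relation.Nullary using (¬_; yes; no)
open import Relation.Nullary.Decidable using (¬?)
open import Relation.Binary.PropositionalEquality using (_≡_; _≢_)
open import Function.Bundles using (_⇔_)
import Data.List as L

-- Vectors in ℤ^n / ℚ^n as functions; a matrix with k columns in ℤ^n is
-- a function from column index to column.
Vecℤ : ℕ → Set
Vecℤ n = Fin n → ℤ

Vecℚ : ℕ → Set
Vecℚ n = Fin n → ℚ

Mat : ℕ → ℕ → Set
Mat n k = Fin k → Vecℤ n

sumℤ : ∀ {k} → (Fin k → ℤ) → ℤ
sumℤ {zero}  f = ℤ.+ 0
sumℤ {suc k} f = f zero ℤ.+ sumℤ (λ j → f (suc j))

sumℚ : ∀ {k} → (Fin k → ℚ) → ℚ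
sumℚ {zero}  f = 0ℚ
sumℚ {suc k} f = f zero ℚ.+ sumℚ (λ j → f (suc j))

ι : ℤ → ℚ
ι z = z ℚ./ 1

⌊_⌋ : ℚ → ℤ
⌊ q ⌋ = ℚ.floor q

frac : ℚ → ℚ
frac q = q ℚ.- ι ⌊ q ⌋

nearest : ℚ → ℤ
nearest q = ℚ.floor (q ℚ.+ ½)

combℤ : ∀ {n k} → Mat n k → (Fin k → ℤ) → Vecℤ n
combℤ M λs r = sumℤ (λ j → λs j ℤ.* M j r)

combℚ : ∀ {n k} → Mat n k → (Fin k → ℚ) → Vecℚ n
combℚ M x r = sumℚ (λ j → x j ℚ.* ι (M j r))

_∈𝓛_ : ∀ {n k} → Vecℤ n → Mat n k → Set
v ∈𝓛 M = ∃ λ λs → ∀ r → combℤ M λs r ≡ v r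

SameLattice : ∀ {n k l} → Mat n k → Mat n l → Set
SameLattice M M' = ∀ v → (v ∈𝓛 M) ⇔ (v ∈𝓛 M')

LinIndep : ∀ {n k} → Mat n k → Set
LinIndep M = ∀ x → (∀ r → combℚ M x r ≡ 0ℚ) → ∀ j → x j ≡ 0ℚ

-- rank(A) = n for A ∈ ℤ^{n×m}: A has n linearly independent columns
-- (column rank ≥ n; ≤ n is automatic in ℤ^n)
RankFull : ∀ {n m} → Mat n m → Set
RankFull {n} {m} A = ∃ λ (σ : Fin n → Fin m) → LinIndep (λ i → A (σ i))

Solves : ∀ {n} → Mat n n → Vecℚ n → Vecℤ n → Set
Solves B x c = ∀ r → combℚ B x r ≡ ι (c r)

IsIntegral : ∀ {n} → Vecℚ n → Set
IsIntegral x = ∀ j → ∃ λ z → x j ≡ ι z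

-- State of the algorithm: current matrix B and multiset C (as a list)
record State (n : ℕ) : Set where
  constructor ⟨_,_⟩
  field
    Bm : Mat n n
    Cs : List (Vecℤ n)
open State public

roundCoeffs : ∀ {n} → Fin n → Vecℚ n → Fin n → ℤ
roundCoeffs i x j with j ≟ i
... | yes _ = nearest (x j)
... | no  _ = ⌊ x j ⌋

setCol : ∀ {n} → Mat n n → Fin n → Vecℤ n → Mat n n
setCol B i v j with j ≟ i
... | yes _ = v
... | no  _ = B j

newCol : ∀ {n} → Mat n n → Fin n → Vecℚ n → Vecℤ n → Vecℤ n
newCol B i x c r = c r ℤ.- combℤ B (roundCoeffs i x) r

-- One iteration of the while loop, for every admissible choice:
-- the element c ∈ C (C = pre ++ c ∷ post) and, in the non-integral case,
-- the index i with {x_i} ≠ 0.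
data Step {n : ℕ} : State n → State n → Set where
  remove : ∀ B pre c post x → Solves B x c → IsIntegral x →
           Step ⟨ B , pre ++ c ∷ post ⟩ ⟨ B , pre ++ post ⟩
  exchange : ∀ B pre c post x i → Solves B x c → frac (x i) ≢ 0ℚ →
           Step ⟨ B , pre ++ c ∷ post ⟩
                ⟨ setCol B i (newCol B i x c) , B i ∷ (pre ++ post) ⟩

-- "every run from s terminates, and every output B satisfies P":
-- either C = ∅ (loop exits, output B), or some step is possible and
-- every possible step leads to a state with the same property.
data AllRunsTerminate {n : ℕ} (P : Mat n n → Set) : State n → Set where
  done : ∀ B → P B → AllRunsTerminate P ⟨ B , [] ⟩
  step : ∀ s → (Cs s ≢ []) → (∃ λ s' → Step s s') →
         (∀ s' → Step s s' → AllRunsTerminate P s') → AllRunsTerminate P s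

-- initial state from a choice σ of n columns of A: B = (A_{σ 1},…,A_{σ n}),
-- C = remaining columns of A (indices not in the image of σ, with multiplicity)
initState : ∀ {n m} → Mat n m → (Fin n → Fin m) → State n
initState {n} {m} A σ =
  ⟨ (λ i → A (σ i)) ,
    map A (filter (λ j → ¬? (any? (λ i → σ i ≟ j))) (L.allFin m)) ⟩

{-# OPTIONS --safe #-}

-- Let B₀ be the initial basis and D a common denominator of the coordinates of the columns
-- of A with respect to B₀, so that D v ∈ 𝓛(B₀) for all v ∈ 𝓛(A). Throughout the loop the
-- columns of B and the vectors of C lie in 𝓛(A) and generate it, B is invertible over ℚ, and
-- D B = B₀ S for an integer matrix S with det S ≠ 0. Removing c ∈ 𝓛(B) keeps S and shortens C.
-- An exchange replaces B i by c - B k = B (x - k), where k is x rounded, and the coordinate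
-- x i - ⌈x i⌋ lies in [-1/2, 1/2] ∖ {0}; so det S is multiplied by it and the nonzero integer
-- |det S| at least halves. Hence (|det S|, |C|) decreases lexicographically, and when C = ∅ the
-- invariant gives 𝓛(B) = 𝓛(A).

module Submission where

open import Defs
open import Algebra.Bundles using (CommutativeRing; RawRing)
open import Data.Empty using (⊥-elim)
open import Data.Fin as Fin using (Fin; zero; suc; punchIn; _≟_)
import Data.Fin.Properties as Fin
open import Data.Fin.Properties using (punchInᵢ≢i)
open import Data.Integer as ℤ using (ℤ; +_; -[1+_])
open import Data.Integer.DivMod as ℤ using ()
import Data.Integer.Properties as ℤ
import Data.Integer.Tactic.RingSolver as ℤ-Solver
open import Data.List using (List; []; _∷_; _++_; map; filter; length; allFin)
import Data.List.Properties as List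
open import Data.List.Membership.Propositional.Properties using (∈-map⁺; ∈-filter⁺; ∈-allFin)
open import Data.List.Relation.Unary.All as All using (All; []; _∷_)
open import Data.List.Relation.Unary.All.Properties as All using (++⁺)
open import Data.Nat as ℕ using (ℕ; zero; suc; _<_; s≤s)
open import Data.Nat.Coprimality as Coprime using ()
open import Data.Nat.Divisibility as ℕ using (_∣_)
import Data.Nat.Properties as ℕ
open import Data.Product using (∃; Σ; _,_; proj₁; proj₂)
open import Data.Rational as ℚ using (ℚ; mkℚ; 0ℚ; 1ℚ; ½; toℚᵘ; ↥_; ↧_; ↧ₙ_)
import Data.Rational.Properties as ℚ
open import Data.Rational.Solver using (module +-*-Solver)
import Data.Rational.Unnormalised as ℚᵘ
import Data.Rational.Unnormalised.Properties as ℚᵘ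
open import Data.Sum using (inj₁; inj₂)
open import Data.Vec.Functional using (updateAt; insertAt)
open import Data.Vec.Functional.Properties
  using (updateAt-updates; updateAt-minimal; updateAt-id-local; updateAt-commutes; map-updateAt-local;
         insertAt-lookup; insertAt-punchIn)
open import Function using (_∘_; const)
open import Function.Bundles using (mk⇔)
open import Relation.Binary.PropositionalEquality
open import Relation.Nullary using (Dec; yes; no; ¬_)
open import Relation.Nullary.Decidable using (¬?)
import Algebra.Properties.AbelianGroup as AbelianGroupProperties
import Algebra.Properties.CommutativeSemigroup as CommutativeSemigroupProperties
import Algebra.Properties.Group as GroupProperties

open +-*-Solver using (solve; _:=_; _:+_; _:*_; :-_; _:-_; con)
open GroupProperties ℚ.+-0-group using (inverseˡ-unique; x∙y⁻¹≈ε⇒x≈y; ⁻¹-involutive)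

-- The embedding ι : ℤ → ℚ

ι-mkℚ : ∀ z → ι z ≡ mkℚ z 0 (Coprime.sym (Coprime.1-coprimeTo ℤ.∣ z ∣))
ι-mkℚ z = ℚ.fromℚᵘ-toℚᵘ _

↥-ι : ∀ z → ↥ ι z ≡ z
↥-ι z rewrite ι-mkℚ z = refl

↧-ι : ∀ z → ↧ ι z ≡ + 1
↧-ι z rewrite ι-mkℚ z = refl

ι-injective : ∀ {a b} → ι a ≡ ι b → a ≡ b
ι-injective {a} {b} e = trans (sym (↥-ι a)) (trans (cong ↥_ e) (↥-ι b))

toℚᵘ-ι : ∀ z → toℚᵘ (ι z) ℚᵘ.≃ ℚᵘ.mkℚᵘ z 0
toℚᵘ-ι z = ℚ.toℚᵘ-fromℚᵘ (ℚᵘ.mkℚᵘ z 0)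

ι-homo-+ : ∀ a b → ι (a ℤ.+ b) ≡ ι a ℚ.+ ι b
ι-homo-+ a b = ℚ.toℚᵘ-injective (begin
  toℚᵘ (ι (a ℤ.+ b))                 ≈⟨ toℚᵘ-ι (a ℤ.+ b) ⟩
  ℚᵘ.mkℚᵘ (a ℤ.+ b) 0                ≈⟨ ℚᵘ.*≡* (cong (ℤ._* + 1) (sym (cong₂ ℤ._+_ (ℤ.*-identityʳ a) (ℤ.*-identityʳ b)))) ⟩
  ℚᵘ.mkℚᵘ a 0 ℚᵘ.+ ℚᵘ.mkℚᵘ b 0       ≈⟨ ℚᵘ.+-cong (toℚᵘ-ι a) (toℚᵘ-ι b) ⟨
  toℚᵘ (ι a) ℚᵘ.+ toℚᵘ (ι b)         ≈⟨ ℚ.toℚᵘ-homo-+ (ι a) (ι b) ⟨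
  toℚᵘ (ι a ℚ.+ ι b)                 ∎)
  where open ℚᵘ.≃-Reasoning

ι-homo-* : ∀ a b → ι (a ℤ.* b) ≡ ι a ℚ.* ι b
ι-homo-* a b = ℚ.toℚᵘ-injective (begin
  toℚᵘ (ι (a ℤ.* b))                 ≈⟨ toℚᵘ-ι (a ℤ.* b) ⟩
  ℚᵘ.mkℚᵘ (a ℤ.* b) 0                ≈⟨ ℚᵘ.*≡* refl ⟩
  ℚᵘ.mkℚᵘ a 0 ℚᵘ.* ℚᵘ.mkℚᵘ b 0       ≈⟨ ℚᵘ.*-cong (toℚᵘ-ι a) (toℚᵘ-ι b) ⟨
  toℚᵘ (ι a) ℚᵘ.* toℚᵘ (ι b)         ≈⟨ ℚ.toℚᵘ-homo-* (ι a) (ι b) ⟨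
  toℚᵘ (ι a ℚ.* ι b)                 ∎)
  where open ℚᵘ.≃-Reasoning

ι-homo-neg : ∀ a → ι (ℤ.- a) ≡ ℚ.- ι a
ι-homo-neg a = inverseˡ-unique (ι (ℤ.- a)) (ι a)
  (trans (sym (ι-homo-+ (ℤ.- a) a)) (cong ι (ℤ.+-inverseˡ a)))

ι-homo-- : ∀ a b → ι (a ℤ.- b) ≡ ι a ℚ.- ι b
ι-homo-- a b = trans (ι-homo-+ a (ℤ.- b)) (cong (ι a ℚ.+_) (ι-homo-neg b))

ι-cancel-≤ : ∀ {a b} → ι a ℚ.≤ ι b → a ℤ.≤ b
ι-cancel-≤ {a} {b} ιa≤ιb = subst₂ ℤ._≤_
  (trans (cong₂ ℤ._*_ (↥-ι a) (↧-ι b)) (ℤ.*-identityʳ a))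
  (trans (cong₂ ℤ._*_ (↥-ι b) (↧-ι a)) (ℤ.*-identityʳ b))
  (ℚ.drop-*≤* ιa≤ιb)

∣ι∣ : ∀ a → ℚ.∣ ι a ∣ ≡ ι (+ ℤ.∣ a ∣)
∣ι∣ a = trans (cong ℚ.∣_∣ (ι-mkℚ a)) (sym (ι-mkℚ (+ ℤ.∣ a ∣)))

ι↧*q≡ι↥ : ∀ q → ι (↧ q) ℚ.* q ≡ ι (↥ q)
ι↧*q≡ι↥ q@(mkℚ p d-1 _) = ℚ.toℚᵘ-injective (begin
  toℚᵘ (ι (↧ q) ℚ.* q)                       ≈⟨ ℚ.toℚᵘ-homo-* (ι (↧ q)) q ⟩
  toℚᵘ (ι (↧ q)) ℚᵘ.* toℚᵘ q                 ≈⟨ ℚᵘ.*-cong (toℚᵘ-ι (↧ q)) ℚᵘ.≃-refl ⟩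
  ℚᵘ.mkℚᵘ (↧ q) 0 ℚᵘ.* ℚᵘ.mkℚᵘ p d-1         ≈⟨ ℚᵘ.*≡* (trans (ℤ.*-identityʳ (+ suc d-1 ℤ.* p)) (trans (ℤ.*-comm (+ suc d-1) p) (cong (λ d → p ℤ.* + suc d) (sym (ℕ.+-identityʳ d-1))))) ⟩
  ℚᵘ.mkℚᵘ p 0                                ≈⟨ toℚᵘ-ι p ⟨
  toℚᵘ (ι p)                                 ∎)
  where open ℚᵘ.≃-Reasoning

-- Rounding

⌊ι⌋ : ∀ k → ⌊ ι k ⌋ ≡ k
⌊ι⌋ k = begin
  ⌊ ι k ⌋                      ≡⟨ cong ⌊_⌋ (ι-mkℚ k) ⟩
  k ℤ./ + 1                    ≡⟨ ℤ.*-identityʳ (k ℤ./ + 1) ⟨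
  (k ℤ./ + 1) ℤ.* + 1          ≡⟨ ℤ.+-identityˡ _ ⟨
  + 0 ℤ.+ (k ℤ./ + 1) ℤ.* + 1  ≡⟨ cong (λ r → + r ℤ.+ (k ℤ./ + 1) ℤ.* + 1) (ℕ.n<1⇒n≡0 (ℤ.n%d<d k (+ 1))) ⟨
  + (k ℤ.% + 1) ℤ.+ (k ℤ./ + 1) ℤ.* + 1 ≡⟨ ℤ.a≡a%n+[a/n]*n k (+ 1) ⟨
  k                            ∎
  where open ≡-Reasoning

ι⌊q⌋≤q : ∀ q → ι ⌊ q ⌋ ℚ.≤ q
ι⌊q⌋≤q q@(mkℚ n _ _) = ℚ.*≤* (begin
  ↥ ι ⌊ q ⌋ ℤ.* ↧ q                ≡⟨ cong (ℤ._* ↧ q) (↥-ι ⌊ q ⌋) ⟩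
  ⌊ q ⌋ ℤ.* ↧ q                    ≤⟨ ℤ.i≤j+i _ (+ (n ℤ.% ↧ q)) ⟩
  + (n ℤ.% ↧ q) ℤ.+ ⌊ q ⌋ ℤ.* ↧ q  ≡⟨ ℤ.a≡a%n+[a/n]*n n (↧ q) ⟨
  n                                ≡⟨ ℤ.*-identityʳ n ⟨
  n ℤ.* + 1                        ≡⟨ cong (n ℤ.*_) (↧-ι ⌊ q ⌋) ⟨
  n ℤ.* ↧ ι ⌊ q ⌋                  ∎)
  where open ℤ.≤-Reasoning

q<ι⌊q⌋+1 : ∀ q → q ℚ.< ι ⌊ q ⌋ ℚ.+ 1ℚ
q<ι⌊q⌋+1 q@(mkℚ n _ _) = subst (q ℚ.<_) (ι-homo-+ ⌊ q ⌋ (+ 1)) (ℚ.*<* (begin-strict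
  n ℤ.* ↧ ι k+1                    ≡⟨ cong (n ℤ.*_) (↧-ι k+1) ⟩
  n ℤ.* + 1                        ≡⟨ ℤ.*-identityʳ n ⟩
  n                                ≡⟨ ℤ.a≡a%n+[a/n]*n n (↧ q) ⟩
  + (n ℤ.% ↧ q) ℤ.+ ⌊ q ⌋ ℤ.* ↧ q  <⟨ ℤ.+-monoˡ-< (⌊ q ⌋ ℤ.* ↧ q) (ℤ.+<+ (ℤ.n%d<d n (↧ q))) ⟩
  ↧ q ℤ.+ ⌊ q ⌋ ℤ.* ↧ q            ≡⟨ cong (ℤ._+ ⌊ q ⌋ ℤ.* ↧ q) (ℤ.*-identityˡ (↧ q)) ⟨
  + 1 ℤ.* ↧ q ℤ.+ ⌊ q ⌋ ℤ.* ↧ q    ≡⟨ ℤ.*-distribʳ-+ (↧ q) (+ 1) ⌊ q ⌋ ⟨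
  (+ 1 ℤ.+ ⌊ q ⌋) ℤ.* ↧ q          ≡⟨ cong (ℤ._* ↧ q) (trans (ℤ.+-comm (+ 1) ⌊ q ⌋) (sym (↥-ι k+1))) ⟩
  ↥ ι k+1 ℤ.* ↧ q                  ∎))
  where
  k+1 = ⌊ q ⌋ ℤ.+ + 1
  open ℤ.≤-Reasoning

0≤frac : ∀ q → 0ℚ ℚ.≤ frac q
0≤frac q = subst (ℚ._≤ frac q) (ℚ.+-inverseʳ (ι ⌊ q ⌋)) (ℚ.+-monoˡ-≤ (ℚ.- ι ⌊ q ⌋) (ι⌊q⌋≤q q))

frac<1 : ∀ q → frac q ℚ.< 1ℚ
frac<1 q = subst (frac q ℚ.<_) (solve 1 (λ k → (k :+ con 1ℚ) :- k := con 1ℚ) refl (ι ⌊ q ⌋))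
  (ℚ.+-monoˡ-< (ℚ.- ι ⌊ q ⌋) (q<ι⌊q⌋+1 q))

frac≡0⇒q≡ι⌊q⌋ : ∀ q → frac q ≡ 0ℚ → q ≡ ι ⌊ q ⌋
frac≡0⇒q≡ι⌊q⌋ q = x∙y⁻¹≈ε⇒x≈y q (ι ⌊ q ⌋)

frac-ι : ∀ k → frac (ι k) ≡ 0ℚ
frac-ι k = trans (cong (λ m → ι k ℚ.- ι m) (⌊ι⌋ k)) (ℚ.+-inverseʳ (ι k))

-r≤p≤r⇒∣p∣≤r : ∀ {p r} → ℚ.- r ℚ.≤ p → p ℚ.≤ r → ℚ.∣ p ∣ ℚ.≤ r
-r≤p≤r⇒∣p∣≤r {p} {r} -r≤p p≤r with ℚ.∣p∣≡p∨∣p∣≡-p p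
... | inj₁ ∣p∣≡p  = subst (ℚ._≤ r) (sym ∣p∣≡p) p≤r
... | inj₂ ∣p∣≡-p = subst₂ ℚ._≤_ (sym ∣p∣≡-p) (⁻¹-involutive r) (ℚ.neg-antimono-≤ -r≤p)

q-⌈q⌋ : ∀ q → q ℚ.- ι (nearest q) ≡ frac (q ℚ.+ ½) ℚ.- ½
q-⌈q⌋ q = solve 3 (λ q h k → q :- k := ((q :+ h) :- k) :- h) refl q ½ (ι (nearest q))

∣q-⌈q⌋∣≤½ : ∀ q → ℚ.∣ q ℚ.- ι (nearest q) ∣ ℚ.≤ ½
∣q-⌈q⌋∣≤½ q = subst (λ p → ℚ.∣ p ∣ ℚ.≤ ½) (sym (q-⌈q⌋ q)) (-r≤p≤r⇒∣p∣≤r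
  (subst (ℚ._≤ f ℚ.- ½) (ℚ.+-identityˡ (ℚ.- ½)) (ℚ.+-monoˡ-≤ (ℚ.- ½) (0≤frac (q ℚ.+ ½))))
  (ℚ.+-monoˡ-≤ (ℚ.- ½) (ℚ.<⇒≤ (frac<1 (q ℚ.+ ½)))))
  where f = frac (q ℚ.+ ½)

q-⌈q⌋≢0 : ∀ q → frac q ≢ 0ℚ → q ℚ.- ι (nearest q) ≢ 0ℚ
q-⌈q⌋≢0 q frac≢0 q≡⌈q⌋ = frac≢0 (subst (λ p → frac p ≡ 0ℚ) (sym (x∙y⁻¹≈ε⇒x≈y q _ q≡⌈q⌋)) (frac-ι (nearest q)))

m+m≤n⇒m<n : ∀ {m n} → m ℕ.+ m ℕ.≤ n → n ≢ 0 → m ℕ.< n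
m+m≤n⇒m<n {zero}  _     n≢0 = ℕ.n≢0⇒n>0 n≢0
m+m≤n⇒m<n {suc m} 2m≤n _   = ℕ.<-≤-trans (ℕ.m<m+n (suc m) ℕ.z<s) 2m≤n

scale≤½⇒∣a∣<∣b∣ : ∀ {a b} z → ℚ.∣ z ∣ ℚ.≤ ½ → ι a ≡ z ℚ.* ι b → ℤ.∣ b ∣ ≢ 0 → ℤ.∣ a ∣ ℕ.< ℤ.∣ b ∣
scale≤½⇒∣a∣<∣b∣ {a} {b} z ∣z∣≤½ a≡zb ∣b∣≢0 = m+m≤n⇒m<n (ℤ.drop‿+≤+ (ι-cancel-≤ 2∣a∣≤∣b∣)) ∣b∣≢0
  where
  open ℚ.≤-Reasoning
  ∣a∣≤½∣b∣ : ι (+ ℤ.∣ a ∣) ℚ.≤ ½ ℚ.* ι (+ ℤ.∣ b ∣)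
  ∣a∣≤½∣b∣ = begin
    ι (+ ℤ.∣ a ∣)                ≡⟨ ∣ι∣ a ⟨
    ℚ.∣ ι a ∣                    ≡⟨ cong ℚ.∣_∣ a≡zb ⟩
    ℚ.∣ z ℚ.* ι b ∣              ≡⟨ ℚ.∣p*q∣≡∣p∣*∣q∣ z (ι b) ⟩
    ℚ.∣ z ∣ ℚ.* ℚ.∣ ι b ∣        ≤⟨ ℚ.*-monoʳ-≤-nonNeg ℚ.∣ ι b ∣ {{ℚ.∣-∣-nonNeg (ι b)}} ∣z∣≤½ ⟩
    ½ ℚ.* ℚ.∣ ι b ∣              ≡⟨ cong (½ ℚ.*_) (∣ι∣ b) ⟩
    ½ ℚ.* ι (+ ℤ.∣ b ∣)          ∎
  2∣a∣≤∣b∣ : ι (+ (ℤ.∣ a ∣ ℕ.+ ℤ.∣ a ∣)) ℚ.≤ ι (+ ℤ.∣ b ∣)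
  2∣a∣≤∣b∣ = begin
    ι (+ (ℤ.∣ a ∣ ℕ.+ ℤ.∣ a ∣))              ≡⟨ ι-homo-+ (+ ℤ.∣ a ∣) (+ ℤ.∣ a ∣) ⟩
    ι (+ ℤ.∣ a ∣) ℚ.+ ι (+ ℤ.∣ a ∣)          ≤⟨ ℚ.+-mono-≤ ∣a∣≤½∣b∣ ∣a∣≤½∣b∣ ⟩
    ½ ℚ.* ι (+ ℤ.∣ b ∣) ℚ.+ ½ ℚ.* ι (+ ℤ.∣ b ∣) ≡⟨ solve 1 (λ y → con ½ :* y :+ con ½ :* y := y) refl (ι (+ ℤ.∣ b ∣)) ⟩
    ι (+ ℤ.∣ b ∣)                            ∎

-- Finite sums over a commutative ring

module FinSum {c ℓ} (R : CommutativeRing c ℓ) where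
  open CommutativeRing R hiding (zero; refl; sym; trans; setoid)

  module Sum (∑ : ∀ {k} → (Fin k → Carrier) → Carrier)
             (∑-zero : ∀ f → ∑ {0} f ≈ 0#)
             (∑-suc : ∀ {k} f → ∑ {suc k} f ≈ f zero + ∑ (f ∘ suc))
             where

    open CommutativeRing R using () renaming (setoid to ≈-setoid; sym to ≈-sym; trans to ≈-trans)
    open import Relation.Binary.Reasoning.Setoid ≈-setoid
    open CommutativeSemigroupProperties +-commutativeSemigroup using (interchange; x∙yz≈y∙xz)
    open AbelianGroupProperties +-abelianGroup using (⁻¹-∙-comm)
    open GroupProperties +-group using (ε⁻¹≈ε)

    ∑-cong : ∀ {k} {f g : Fin k → Carrier} → (∀ j → f j ≈ g j) → ∑ f ≈ ∑ g
    ∑-cong {zero}  {f} {g} _   = ≈-trans (∑-zero f) (≈-sym (∑-zero g))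
    ∑-cong {suc k} {f} {g} f≈g = begin
      ∑ f                  ≈⟨ ∑-suc f ⟩
      f zero + ∑ (f ∘ suc) ≈⟨ +-cong (f≈g zero) (∑-cong (f≈g ∘ suc)) ⟩
      g zero + ∑ (g ∘ suc) ≈⟨ ∑-suc g ⟨
      ∑ g                  ∎

    ∑-0# : ∀ {k} {f : Fin k → Carrier} → (∀ j → f j ≈ 0#) → ∑ f ≈ 0#
    ∑-0# {zero}  {f} _    = ∑-zero f
    ∑-0# {suc k} {f} f≈0 = begin
      ∑ f                  ≈⟨ ∑-suc f ⟩
      f zero + ∑ (f ∘ suc) ≈⟨ +-cong (f≈0 zero) (∑-0# (f≈0 ∘ suc)) ⟩
      0# + 0#              ≈⟨ +-identityˡ 0# ⟩
      0#                   ∎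

    ∑-distrib-+ : ∀ {k} (f g : Fin k → Carrier) → ∑ (λ j → f j + g j) ≈ ∑ f + ∑ g
    ∑-distrib-+ {zero}  f g = ≈-trans (∑-zero _) (≈-sym (≈-trans (+-cong (∑-zero f) (∑-zero g)) (+-identityˡ 0#)))
    ∑-distrib-+ {suc k} f g = begin
      ∑ (λ j → f j + g j)                                     ≈⟨ ∑-suc _ ⟩
      (f zero + g zero) + ∑ (λ j → f (suc j) + g (suc j))      ≈⟨ +-congˡ (∑-distrib-+ (f ∘ suc) (g ∘ suc)) ⟩
      (f zero + g zero) + (∑ (f ∘ suc) + ∑ (g ∘ suc))          ≈⟨ interchange _ _ _ _ ⟩
      (f zero + ∑ (f ∘ suc)) + (g zero + ∑ (g ∘ suc))          ≈⟨ +-cong (∑-suc f) (∑-suc g) ⟨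
      ∑ f + ∑ g                                               ∎

    *-distribˡ-∑ : ∀ {k} x (f : Fin k → Carrier) → x * ∑ f ≈ ∑ (λ j → x * f j)
    *-distribˡ-∑ {zero}  x f = ≈-trans (*-congˡ (∑-zero f)) (≈-trans (zeroʳ x) (≈-sym (∑-zero _)))
    *-distribˡ-∑ {suc k} x f = begin
      x * ∑ f                          ≈⟨ *-congˡ (∑-suc f) ⟩
      x * (f zero + ∑ (f ∘ suc))       ≈⟨ distribˡ x _ _ ⟩
      x * f zero + x * ∑ (f ∘ suc)     ≈⟨ +-congˡ (*-distribˡ-∑ x (f ∘ suc)) ⟩
      x * f zero + ∑ (λ j → x * f (suc j)) ≈⟨ ∑-suc _ ⟨
      ∑ (λ j → x * f j)                ∎

    *-distribʳ-∑ : ∀ {k} x (f : Fin k → Carrier) → ∑ f * x ≈ ∑ (λ j → f j * x)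
    *-distribʳ-∑ x f = ≈-trans (*-comm (∑ f) x) (≈-trans (*-distribˡ-∑ x f) (∑-cong (λ j → *-comm x (f j))))

    ∑-distrib-neg : ∀ {k} (f : Fin k → Carrier) → ∑ (λ j → - f j) ≈ - ∑ f
    ∑-distrib-neg {zero}  f = ≈-trans (∑-zero _) (≈-trans (≈-sym ε⁻¹≈ε) (-‿cong (≈-sym (∑-zero f))))
    ∑-distrib-neg {suc k} f = begin
      ∑ (λ j → - f j)                    ≈⟨ ∑-suc _ ⟩
      - f zero + ∑ (λ j → - f (suc j))   ≈⟨ +-congˡ (∑-distrib-neg (f ∘ suc)) ⟩
      - f zero + - ∑ (f ∘ suc)           ≈⟨ ⁻¹-∙-comm _ _ ⟩
      - (f zero + ∑ (f ∘ suc))           ≈⟨ -‿cong (∑-suc f) ⟨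
      - ∑ f                              ∎

    ∑-distrib-- : ∀ {k} (f g : Fin k → Carrier) → ∑ (λ j → f j - g j) ≈ ∑ f - ∑ g
    ∑-distrib-- f g = ≈-trans (∑-distrib-+ f (λ j → - g j)) (+-congˡ (∑-distrib-neg g))

    ∑-comm : ∀ {k l} (f : Fin k → Fin l → Carrier) → ∑ (λ i → ∑ (f i)) ≈ ∑ (λ j → ∑ (λ i → f i j))
    ∑-comm {zero}  f = ≈-trans (∑-zero _) (≈-sym (∑-0# (λ j → ∑-zero _)))
    ∑-comm {suc k} f = begin
      ∑ (λ i → ∑ (f i))                                     ≈⟨ ∑-suc _ ⟩
      ∑ (f zero) + ∑ (λ i → ∑ (f (suc i)))                  ≈⟨ +-congˡ (∑-comm (f ∘ suc)) ⟩
      ∑ (f zero) + ∑ (λ j → ∑ (λ i → f (suc i) j))          ≈⟨ ∑-distrib-+ (f zero) _ ⟨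
      ∑ (λ j → f zero j + ∑ (λ i → f (suc i) j))            ≈⟨ ∑-cong (λ j → ∑-suc (λ i → f i j)) ⟨
      ∑ (λ j → ∑ (λ i → f i j))                             ∎

    ∑-punchIn : ∀ {k} (p : Fin (suc k)) (f : Fin (suc k) → Carrier) → ∑ f ≈ f p + ∑ (f ∘ punchIn p)
    ∑-punchIn zero f = ∑-suc f
    ∑-punchIn {suc k} (suc p) f = begin
      ∑ f                                            ≈⟨ ∑-suc f ⟩
      f zero + ∑ (f ∘ suc)                           ≈⟨ +-congˡ (∑-punchIn p (f ∘ suc)) ⟩
      f zero + (f (suc p) + ∑ (f ∘ suc ∘ punchIn p))  ≈⟨ x∙yz≈y∙xz _ _ _ ⟩
      f (suc p) + (f zero + ∑ (f ∘ suc ∘ punchIn p))  ≈⟨ +-congˡ (∑-suc (f ∘ punchIn (suc p))) ⟨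
      f (suc p) + ∑ (f ∘ punchIn (suc p))            ∎

    ∑-δ : ∀ {k} (i : Fin k) {f : Fin k → Carrier} → (∀ j → j ≢ i → f j ≈ 0#) → ∑ f ≈ f i
    ∑-δ {suc k} i {f} f≈0 = begin
      ∑ f                        ≈⟨ ∑-punchIn i f ⟩
      f i + ∑ (f ∘ punchIn i)    ≈⟨ +-congˡ (∑-0# (λ j → f≈0 (punchIn i j) (punchInᵢ≢i i j))) ⟩
      f i + 0#                   ≈⟨ +-identityʳ (f i) ⟩
      f i                        ∎

module ℤ-Sum = FinSum.Sum ℤ.+-*-commutativeRing sumℤ (λ _ → refl) (λ _ → refl)
module ℚ-Sum = FinSum.Sum ℚ.+-*-commutativeRing sumℚ (λ _ → refl) (λ _ → refl)

-- Determinants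

infixl 9 _[_]≔_

_[_]≔_ : ∀ {A : Set} {k} → (Fin k → A) → Fin k → A → Fin k → A
M [ i ]≔ w = updateAt M i (const w)

module _ {A : Set} {k} (M : Fin k → A) (i : Fin k) where

  []≔-updates : ∀ w → (M [ i ]≔ w) i ≡ w
  []≔-updates w = updateAt-updates i M

  []≔-minimal : ∀ w {j} → j ≢ i → (M [ i ]≔ w) j ≡ M j
  []≔-minimal w {j} j≢i = updateAt-minimal j i M j≢i

  []≔-self : ∀ j → (M [ i ]≔ M i) j ≡ M j
  []≔-self = updateAt-id-local i M refl

  []≔-map : ∀ {B : Set} (g : A → B) w j → g ((M [ i ]≔ w) j) ≡ ((g ∘ M) [ i ]≔ g w) j
  []≔-map g w = map-updateAt-local {f = g} {g = const w} M i refl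

minor : ∀ {a} {A : Set a} {n} → Fin (suc n) → (Fin (suc n) → Fin (suc n) → A) → Fin n → Fin n → A
minor r M j s = M (suc j) (punchIn r s)

module Determinant {c ℓ} (R : RawRing c ℓ) where
  open RawRing R

  alternatingSum : ∀ {k} → (Fin k → Carrier) → Carrier
  alternatingSum {zero}  f = 0#
  alternatingSum {suc k} f = f zero + - alternatingSum (f ∘ suc)

  det : ∀ {n} → (Fin n → Fin n → Carrier) → Carrier
  det {zero}  M = 1#
  det {suc n} M = alternatingSum (λ r → M zero r * det (minor r M))

open Determinant ℚ.+-*-rawRing public

QMat : ℕ → Set
QMat n = Fin n → Vecℚ n

altSum-cong : ∀ {k} {f g : Fin k → ℚ} → (∀ j → f j ≡ g j) → alternatingSum f ≡ alternatingSum g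
altSum-cong {zero}  _   = refl
altSum-cong {suc k} f≡g = cong₂ ℚ._-_ (f≡g zero) (altSum-cong (f≡g ∘ suc))

altSum-linear : ∀ {k} a b (f g : Fin k → ℚ) →
  alternatingSum (λ j → a ℚ.* f j ℚ.+ b ℚ.* g j) ≡ a ℚ.* alternatingSum f ℚ.+ b ℚ.* alternatingSum g
altSum-linear {zero}  a b f g = solve 2 (λ a b → con 0ℚ := a :* con 0ℚ :+ b :* con 0ℚ) refl a b
altSum-linear {suc k} a b f g = trans
  (cong (λ s → a ℚ.* f zero ℚ.+ b ℚ.* g zero ℚ.- s) (altSum-linear a b (f ∘ suc) (g ∘ suc)))
  (solve 6 (λ a b x y u v → a :* x :+ b :* y :- (a :* u :+ b :* v) := a :* (x :- u) :+ b :* (y :- v))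
         refl a b (f zero) (g zero) (alternatingSum (f ∘ suc)) (alternatingSum (g ∘ suc)))

altSum-0 : ∀ {k} {f : Fin k → ℚ} → (∀ j → f j ≡ 0ℚ) → alternatingSum f ≡ 0ℚ
altSum-0 {zero}  _   = refl
altSum-0 {suc k} f≡0 = cong₂ ℚ._-_ (f≡0 zero) (altSum-0 (f≡0 ∘ suc))

*-distribˡ-altSum : ∀ {k} a (f : Fin k → ℚ) → a ℚ.* alternatingSum f ≡ alternatingSum (λ j → a ℚ.* f j)
*-distribˡ-altSum a f = sym (begin
  alternatingSum (λ j → a ℚ.* f j)                       ≡⟨ altSum-cong (λ j → solve 2 (λ a x → a :* x := a :* x :+ con 0ℚ :* x) refl a (f j)) ⟩
  alternatingSum (λ j → a ℚ.* f j ℚ.+ 0ℚ ℚ.* f j)         ≡⟨ altSum-linear a 0ℚ f f ⟩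
  a ℚ.* alternatingSum f ℚ.+ 0ℚ ℚ.* alternatingSum f     ≡⟨ solve 2 (λ a x → a :* x :+ con 0ℚ :* x := a :* x) refl a (alternatingSum f) ⟩
  a ℚ.* alternatingSum f                                 ∎)
  where open ≡-Reasoning

altSum-distrib-- : ∀ {k} (f g : Fin k → ℚ) → alternatingSum (λ j → f j ℚ.- g j) ≡ alternatingSum f ℚ.- alternatingSum g
altSum-distrib-- f g = begin
  alternatingSum (λ j → f j ℚ.- g j)                        ≡⟨ altSum-cong (λ j → solve 2 (λ x y → x :- y := con 1ℚ :* x :+ (:- con 1ℚ) :* y) refl (f j) (g j)) ⟩
  alternatingSum (λ j → 1ℚ ℚ.* f j ℚ.+ ℚ.- 1ℚ ℚ.* g j)        ≡⟨ altSum-linear 1ℚ (ℚ.- 1ℚ) f g ⟩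
  1ℚ ℚ.* alternatingSum f ℚ.+ ℚ.- 1ℚ ℚ.* alternatingSum g    ≡⟨ solve 2 (λ x y → con 1ℚ :* x :+ (:- con 1ℚ) :* y := x :- y) refl (alternatingSum f) (alternatingSum g) ⟩
  alternatingSum f ℚ.- alternatingSum g                     ∎
  where open ≡-Reasoning

det-cong : ∀ {n} {M N : QMat n} → (∀ j r → M j r ≡ N j r) → det M ≡ det N
det-cong {zero}  _   = refl
det-cong {suc n} M≡N = altSum-cong (λ r → cong₂ ℚ._*_ (M≡N zero r) (det-cong (λ j s → M≡N (suc j) (punchIn r s))))

det-[]≔-cong : ∀ {n} (M : QMat n) i {u v : Vecℚ n} → (∀ r → u r ≡ v r) → det (M [ i ]≔ u) ≡ det (M [ i ]≔ v)
det-[]≔-cong M i {u} {v} u≗v = det-cong λ j r → begin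
  (M [ i ]≔ u) j r                  ≡⟨ []≔-map M i (λ col → col r) u j ⟩
  ((λ j → M j r) [ i ]≔ u r) j      ≡⟨ cong (λ x → ((λ j → M j r) [ i ]≔ x) j) (u≗v r) ⟩
  ((λ j → M j r) [ i ]≔ v r) j      ≡⟨ []≔-map M i (λ col → col r) v j ⟨
  (M [ i ]≔ v) j r                  ∎
  where open ≡-Reasoning

minor-[suc]≔ : ∀ {A : Set} {n} r i (M : Fin (suc n) → Fin (suc n) → A) w j s →
  minor r (M [ suc i ]≔ w) j s ≡ (minor r M [ i ]≔ (w ∘ punchIn r)) j s
minor-[suc]≔ r i M w j s = cong (λ col → col s) ([]≔-map (M ∘ suc) i (_∘ punchIn r) w j)

det-linear : ∀ {n} (M : QMat n) i a b (u v : Vecℚ n) →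
  det (M [ i ]≔ (λ r → a ℚ.* u r ℚ.+ b ℚ.* v r)) ≡ a ℚ.* det (M [ i ]≔ u) ℚ.+ b ℚ.* det (M [ i ]≔ v)
det-linear {suc n} M zero a b u v = trans
  (altSum-cong λ r → solve 5 (λ a b x y d → (a :* x :+ b :* y) :* d := a :* (x :* d) :+ b :* (y :* d))
                             refl a b (u r) (v r) (det (minor r M)))
  (altSum-linear a b (λ r → u r ℚ.* det (minor r M)) (λ r → v r ℚ.* det (minor r M)))
det-linear {suc n} M (suc i) a b u v = trans (altSum-cong expand) (altSum-linear a b (λ r → M zero r ℚ.* detMinor u r) (λ r → M zero r ℚ.* detMinor v r))
  where
  open ≡-Reasoning
  detMinor : Vecℚ (suc n) → Fin (suc n) → ℚ
  detMinor w r = det (minor r (M [ suc i ]≔ w))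
  detMinor-[]≔ : ∀ w r → detMinor w r ≡ det (minor r M [ i ]≔ (w ∘ punchIn r))
  detMinor-[]≔ w r = det-cong (minor-[suc]≔ r i M w)
  expand : ∀ r → M zero r ℚ.* detMinor (λ r → a ℚ.* u r ℚ.+ b ℚ.* v r) r
               ≡ a ℚ.* (M zero r ℚ.* detMinor u r) ℚ.+ b ℚ.* (M zero r ℚ.* detMinor v r)
  expand r = begin
    M zero r ℚ.* detMinor _ r
      ≡⟨ cong (M zero r ℚ.*_) (trans (detMinor-[]≔ _ r) (det-linear (minor r M) i a b (u ∘ punchIn r) (v ∘ punchIn r))) ⟩
    M zero r ℚ.* (a ℚ.* det (minor r M [ i ]≔ (u ∘ punchIn r)) ℚ.+ b ℚ.* det (minor r M [ i ]≔ (v ∘ punchIn r)))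
      ≡⟨ cong₂ (λ x y → M zero r ℚ.* (a ℚ.* x ℚ.+ b ℚ.* y)) (detMinor-[]≔ u r) (detMinor-[]≔ v r) ⟨
    M zero r ℚ.* (a ℚ.* detMinor u r ℚ.+ b ℚ.* detMinor v r)
      ≡⟨ solve 5 (λ m a b x y → m :* (a :* x :+ b :* y) := a :* (m :* x) :+ b :* (m :* y)) refl (M zero r) a b (detMinor u r) (detMinor v r) ⟩
    a ℚ.* (M zero r ℚ.* detMinor u r) ℚ.+ b ℚ.* (M zero r ℚ.* detMinor v r)
      ∎

module _ {n} (M : QMat n) (i : Fin n) where
  open ≡-Reasoning

  det-[]≔-* : ∀ a (u : Vecℚ n) → det (M [ i ]≔ (λ r → a ℚ.* u r)) ≡ a ℚ.* det (M [ i ]≔ u)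
  det-[]≔-* a u = begin
    det (M [ i ]≔ (λ r → a ℚ.* u r))                     ≡⟨ det-[]≔-cong M i (λ r → solve 2 (λ a x → a :* x := a :* x :+ con 0ℚ :* x) refl a (u r)) ⟩
    det (M [ i ]≔ (λ r → a ℚ.* u r ℚ.+ 0ℚ ℚ.* u r))       ≡⟨ det-linear M i a 0ℚ u u ⟩
    a ℚ.* det (M [ i ]≔ u) ℚ.+ 0ℚ ℚ.* det (M [ i ]≔ u)   ≡⟨ solve 2 (λ a x → a :* x :+ con 0ℚ :* x := a :* x) refl a (det (M [ i ]≔ u)) ⟩
    a ℚ.* det (M [ i ]≔ u)                               ∎

  det-[]≔-+ : ∀ (u v : Vecℚ n) → det (M [ i ]≔ (λ r → u r ℚ.+ v r)) ≡ det (M [ i ]≔ u) ℚ.+ det (M [ i ]≔ v)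
  det-[]≔-+ u v = begin
    det (M [ i ]≔ (λ r → u r ℚ.+ v r))                            ≡⟨ det-[]≔-cong M i (λ r → solve 2 (λ x y → x :+ y := con 1ℚ :* x :+ con 1ℚ :* y) refl (u r) (v r)) ⟩
    det (M [ i ]≔ (λ r → 1ℚ ℚ.* u r ℚ.+ 1ℚ ℚ.* v r))              ≡⟨ det-linear M i 1ℚ 1ℚ u v ⟩
    1ℚ ℚ.* det (M [ i ]≔ u) ℚ.+ 1ℚ ℚ.* det (M [ i ]≔ v)          ≡⟨ cong₂ ℚ._+_ (ℚ.*-identityˡ (det (M [ i ]≔ u))) (ℚ.*-identityˡ (det (M [ i ]≔ v))) ⟩
    det (M [ i ]≔ u) ℚ.+ det (M [ i ]≔ v)                        ∎

  det-[]≔-0 : det (M [ i ]≔ (λ _ → 0ℚ)) ≡ 0ℚ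
  det-[]≔-0 = begin
    det (M [ i ]≔ (λ _ → 0ℚ))               ≡⟨ det-[]≔-cong M i (λ r → sym (ℚ.*-zeroˡ (M i r))) ⟩
    det (M [ i ]≔ (λ r → 0ℚ ℚ.* M i r))     ≡⟨ det-[]≔-* 0ℚ (M i) ⟩
    0ℚ ℚ.* det (M [ i ]≔ M i)               ≡⟨ ℚ.*-zeroˡ (det (M [ i ]≔ M i)) ⟩
    0ℚ                                      ∎

  det-[]≔-∑ : ∀ {k} (g : Fin k → Vecℚ n) → det (M [ i ]≔ (λ r → sumℚ (λ j → g j r))) ≡ sumℚ (λ j → det (M [ i ]≔ g j))
  det-[]≔-∑ {zero}  g = det-[]≔-0
  det-[]≔-∑ {suc k} g = trans (det-[]≔-+ (g zero) _) (cong (det (M [ i ]≔ g zero) ℚ.+_) (det-[]≔-∑ (g ∘ suc)))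

-- det M for M with first two columns equal to a, expanded along both of them; Φ f is the
-- determinant of the remaining columns restricted to the rows f.
doubleExpansion : ∀ {k} → (Fin (suc (suc k)) → ℚ) → ((Fin k → Fin (suc (suc k))) → ℚ) → ℚ
doubleExpansion a Φ = alternatingSum λ r → alternatingSum λ s →
  a r ℚ.* a (punchIn r s) ℚ.* Φ (λ t → punchIn r (punchIn s t))

-- The terms with r = 0 coincide with those with s = 0, r = suc s and cancel out;
-- what remains is the expansion for a ∘ suc.
doubleExpansion-peel : ∀ {k} a (Φ : (Fin k → Fin (suc (suc k))) → ℚ) →
  doubleExpansion a Φ ≡ alternatingSum λ r → alternatingSum λ s →
    a (suc r) ℚ.* a (suc (punchIn r s)) ℚ.* Φ (λ t → punchIn (suc r) (punchIn (suc s) t))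
doubleExpansion-peel a Φ = begin
  doubleExpansion a Φ                         ≡⟨ cong₂ ℚ._-_ X≡Y (altSum-distrib-- Y W) ⟩
  alternatingSum Y ℚ.- (alternatingSum Y ℚ.- alternatingSum W)
                                              ≡⟨ solve 2 (λ y w → y :- (y :- w) := w) refl (alternatingSum Y) (alternatingSum W) ⟩
  alternatingSum W                            ∎
  where
  open ≡-Reasoning
  Y W : Fin (suc _) → ℚ
  Y r = a (suc r) ℚ.* a zero ℚ.* Φ (λ t → punchIn (suc r) (suc t))
  W r = alternatingSum λ s → a (suc r) ℚ.* a (suc (punchIn r s)) ℚ.* Φ (λ t → punchIn (suc r) (punchIn (suc s) t))
  X≡Y : alternatingSum (λ s → a zero ℚ.* a (suc s) ℚ.* Φ (λ t → suc (punchIn s t))) ≡ alternatingSum Y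
  X≡Y = altSum-cong λ s → cong (ℚ._* Φ (λ t → suc (punchIn s t))) (ℚ.*-comm (a zero) (a (suc s)))

doubleExpansion≡0 : ∀ {k} a (Φ : (Fin k → Fin (suc (suc k))) → ℚ) →
  (∀ {f g} → (∀ t → f t ≡ g t) → Φ f ≡ Φ g) → doubleExpansion a Φ ≡ 0ℚ
doubleExpansion≡0 {zero}  a Φ Φ-cong = doubleExpansion-peel a Φ
doubleExpansion≡0 {suc k} a Φ Φ-cong = trans (doubleExpansion-peel a Φ)
  (trans (altSum-cong λ r → altSum-cong λ s → cong (a (suc r) ℚ.* a (suc (punchIn r s)) ℚ.*_) (Φ-cong (lift-punchIn r s)))
         (doubleExpansion≡0 (a ∘ suc) (Φ ∘ Fin.lift 1) (λ f≗g → Φ-cong (lift-cong f≗g))))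
  where
  lift-punchIn : ∀ r s t → punchIn (suc r) (punchIn (suc s) t) ≡ Fin.lift 1 (λ t → punchIn r (punchIn s t)) t
  lift-punchIn r s zero    = refl
  lift-punchIn r s (suc t) = refl
  lift-cong : ∀ {l m} {f g : Fin l → Fin m} → (∀ t → f t ≡ g t) → ∀ t → Fin.lift 1 f t ≡ Fin.lift 1 g t
  lift-cong f≗g zero    = refl
  lift-cong f≗g (suc t) = cong suc (f≗g t)

det-firstColumns-equal : ∀ {n} (M : QMat (suc (suc n))) → (∀ r → M zero r ≡ M (suc zero) r) → det M ≡ 0ℚ
det-firstColumns-equal {n} M M₀≡M₁ = trans (altSum-cong expand) (doubleExpansion≡0 (M zero) Φ (λ f≗g → det-cong (λ j t → cong (M (suc (suc j))) (f≗g t))))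
  where
  Φ : (Fin n → Fin (suc (suc n))) → ℚ
  Φ f = det (λ j t → M (suc (suc j)) (f t))
  expand : ∀ r → M zero r ℚ.* det (minor r M)
                 ≡ alternatingSum (λ s → M zero r ℚ.* M zero (punchIn r s) ℚ.* Φ (λ t → punchIn r (punchIn s t)))
  expand r = trans (*-distribˡ-altSum (M zero r) (λ s → M (suc zero) (punchIn r s) ℚ.* Φ (λ t → punchIn r (punchIn s t)))) (altSum-cong λ s →
    trans (cong (λ x → M zero r ℚ.* (x ℚ.* Φ (λ t → punchIn r (punchIn s t)))) (sym (M₀≡M₁ (punchIn r s))))
          (sym (ℚ.*-assoc (M zero r) (M zero (punchIn r s)) _)))

Alternating : ℕ → Set
Alternating n = ∀ (M : QMat n) i j → i ≢ j → (∀ r → M i r ≡ M j r) → det M ≡ 0ℚ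

-- f a b (columns p, q replaced by a, b) is bilinear and vanishes on the diagonal, hence
-- f u v + f v u = f (u + v) (u + v) - f u u - f v v = 0.
det-swap : ∀ {n} → Alternating n → (M : QMat n) (p q : Fin n) → p ≢ q →
  det (M [ q ]≔ M p [ p ]≔ M q) ≡ ℚ.- det M
det-swap {n} alt M p q p≢q = trans (inverseˡ-unique (f v u) (f u v) f-antisym) (cong ℚ.-_ f-uv≡det)
  where
  open ≡-Reasoning
  u = M p
  v = M q
  _⊕_ : Vecℚ n → Vecℚ n → Vecℚ n
  (a ⊕ b) r = a r ℚ.+ b r
  f : Vecℚ n → Vecℚ n → ℚ
  f a b = det (M [ q ]≔ b [ p ]≔ a)
  f-diag : ∀ a → f a a ≡ 0ℚ
  f-diag a = alt _ p q p≢q λ r → cong (λ col → col r)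
    (trans ([]≔-updates (M [ q ]≔ a) p a) (sym (trans ([]≔-minimal (M [ q ]≔ a) p a (p≢q ∘ sym)) ([]≔-updates M q a))))
  commute : ∀ a b j r → (M [ q ]≔ b [ p ]≔ a) j r ≡ (M [ p ]≔ a [ q ]≔ b) j r
  commute a b j r = cong (λ col → col r) (updateAt-commutes p q p≢q M j)
  f-additiveʳ : ∀ a b c → f a (b ⊕ c) ≡ f a b ℚ.+ f a c
  f-additiveʳ a b c = trans (det-cong (commute a (b ⊕ c))) (trans (det-[]≔-+ (M [ p ]≔ a) q b c)
    (sym (cong₂ ℚ._+_ (det-cong (commute a b)) (det-cong (commute a c)))))
  f-antisym : f v u ℚ.+ f u v ≡ 0ℚ
  f-antisym = begin
    f v u ℚ.+ f u v                              ≡⟨ solve 2 (λ a b → a :+ b := (con 0ℚ :+ b) :+ (a :+ con 0ℚ)) refl (f v u) (f u v) ⟩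
    (0ℚ ℚ.+ f u v) ℚ.+ (f v u ℚ.+ 0ℚ)            ≡⟨ cong₂ (λ x y → (x ℚ.+ f u v) ℚ.+ (f v u ℚ.+ y)) (f-diag u) (f-diag v) ⟨
    (f u u ℚ.+ f u v) ℚ.+ (f v u ℚ.+ f v v)      ≡⟨ cong₂ ℚ._+_ (f-additiveʳ u u v) (f-additiveʳ v u v) ⟨
    f u (u ⊕ v) ℚ.+ f v (u ⊕ v)                  ≡⟨ det-[]≔-+ (M [ q ]≔ (u ⊕ v)) p u v ⟨
    f (u ⊕ v) (u ⊕ v)                            ≡⟨ f-diag (u ⊕ v) ⟩
    0ℚ                                           ∎
  f-uv≡det : f u v ≡ det M
  f-uv≡det = det-cong λ j r → cong (λ col → col r) (begin
    (M [ q ]≔ v [ p ]≔ u) j                      ≡⟨ cong (λ w → (M [ q ]≔ v [ p ]≔ w) j) ([]≔-minimal M q v (p≢q)) ⟨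
    (M [ q ]≔ v [ p ]≔ (M [ q ]≔ v) p) j         ≡⟨ []≔-self (M [ q ]≔ v) p j ⟩
    (M [ q ]≔ v) j                               ≡⟨ []≔-self M q j ⟩
    M j                                          ∎)

-- Swapping columns 1 and suc j in every minor negates det M and makes its first two columns equal.
det-column₀-equal : ∀ {n} → Alternating n → (M : QMat (suc n)) (j : Fin n) → (∀ r → M zero r ≡ M (suc j) r) → det M ≡ 0ℚ
det-column₀-equal {suc n}       alt M zero    M₀≡M₁ = det-firstColumns-equal M M₀≡M₁
det-column₀-equal {suc (suc n)} alt M (suc j) M₀≡Mⱼ = begin
  det M            ≡⟨ ⁻¹-involutive (det M) ⟨
  ℚ.- ℚ.- det M    ≡⟨ cong ℚ.-_ det-M′ ⟨
  ℚ.- det M′       ≡⟨ cong ℚ.-_ (det-firstColumns-equal M′ M₀≡Mⱼ) ⟩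
  0ℚ               ∎
  where
  open ≡-Reasoning
  M′ = M [ suc (suc j) ]≔ M (suc zero) [ suc zero ]≔ M (suc (suc j))
  minor-M′ : ∀ r j′ s → minor r M′ j′ s ≡ (minor r M [ suc j ]≔ minor r M zero [ zero ]≔ minor r M (suc j)) j′ s
  minor-M′ r zero     s = refl
  minor-M′ r (suc j′) s = minor-[suc]≔ r (suc j) M (M (suc zero)) (suc j′) s
  det-M′ : det M′ ≡ ℚ.- det M
  det-M′ = begin
    det M′                                                 ≡⟨ altSum-cong (λ r → cong (M zero r ℚ.*_) (trans (det-cong (minor-M′ r)) (det-swap alt (minor r M) zero (suc j) (λ ())))) ⟩
    alternatingSum (λ r → M zero r ℚ.* ℚ.- det (minor r M))         ≡⟨ altSum-cong (λ r → solve 2 (λ a d → a :* (:- d) := (:- con 1ℚ) :* (a :* d)) refl (M zero r) (det (minor r M))) ⟩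
    alternatingSum (λ r → ℚ.- 1ℚ ℚ.* (M zero r ℚ.* det (minor r M))) ≡⟨ *-distribˡ-altSum (ℚ.- 1ℚ) (λ r → M zero r ℚ.* det (minor r M)) ⟨
    ℚ.- 1ℚ ℚ.* det M                                                ≡⟨ solve 1 (λ d → (:- con 1ℚ) :* d := :- d) refl (det M) ⟩
    ℚ.- det M                                                       ∎

det-alternating : ∀ {n} → Alternating n
det-alternating {suc n} M zero    zero    0≢0 _     = ⊥-elim (0≢0 refl)
det-alternating {suc n} M zero    (suc j) _   M₀≡Mⱼ = det-column₀-equal det-alternating M j M₀≡Mⱼ
det-alternating {suc n} M (suc i) zero    _   Mᵢ≡M₀ = det-column₀-equal det-alternating M i (sym ∘ Mᵢ≡M₀)
det-alternating {suc n} M (suc i) (suc j) i≢j Mᵢ≡Mⱼ = altSum-0 λ r →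
  trans (cong (M zero r ℚ.*_) (det-alternating (minor r M) i j (i≢j ∘ cong suc) (Mᵢ≡Mⱼ ∘ punchIn r)))
        (ℚ.*-zeroʳ (M zero r))

det-[]≔-comb : ∀ {n} (M : QMat n) i (y : Vecℚ n) → det (M [ i ]≔ (λ r → sumℚ (λ j → y j ℚ.* M j r))) ≡ y i ℚ.* det M
det-[]≔-comb M i y = begin
  det (M [ i ]≔ (λ r → sumℚ (λ j → y j ℚ.* M j r)))   ≡⟨ det-[]≔-∑ M i (λ j r → y j ℚ.* M j r) ⟩
  sumℚ (λ j → det (M [ i ]≔ (λ r → y j ℚ.* M j r)))   ≡⟨ ℚ-Sum.∑-cong (λ j → det-[]≔-* M i (y j) (M j)) ⟩
  sumℚ (λ j → y j ℚ.* det (M [ i ]≔ M j))             ≡⟨ ℚ-Sum.∑-δ i (λ j j≢i → trans (cong (y j ℚ.*_) (repeated j j≢i)) (ℚ.*-zeroʳ (y j))) ⟩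
  y i ℚ.* det (M [ i ]≔ M i)                          ≡⟨ cong (y i ℚ.*_) (det-cong (λ j r → cong (λ col → col r) ([]≔-self M i j))) ⟩
  y i ℚ.* det M                                       ∎
  where
  open ≡-Reasoning
  repeated : ∀ j → j ≢ i → det (M [ i ]≔ M j) ≡ 0ℚ
  repeated j j≢i = det-alternating _ i j (j≢i ∘ sym) λ r →
    cong (λ col → col r) (trans ([]≔-updates M i (M j)) (sym ([]≔-minimal M i (M j) j≢i)))

module ℤ-Determinant = Determinant ℤ.+-*-rawRing

detℤ : ∀ {n} → Mat n n → ℤ
detℤ = ℤ-Determinant.det

ι-altSum : ∀ {k} (f : Fin k → ℤ) → ι (ℤ-Determinant.alternatingSum f) ≡ alternatingSum (ι ∘ f)
ι-altSum {zero}  f = refl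
ι-altSum {suc k} f = trans (ι-homo-- (f zero) _) (cong (λ x → ι (f zero) ℚ.- x) (ι-altSum (f ∘ suc)))

ι-det : ∀ {n} (M : Mat n n) → ι (detℤ M) ≡ det (λ j r → ι (M j r))
ι-det {zero}  M = refl
ι-det {suc n} M = trans (ι-altSum (λ r → M zero r ℤ.* detℤ (minor r M))) (altSum-cong λ r →
  trans (ι-homo-* (M zero r) (detℤ (minor r M))) (cong (ι (M zero r) ℚ.*_) (ι-det (minor r M))))

δ : ∀ {n} → Fin n → Fin n → ℤ
δ zero    zero    = + 1
δ zero    (suc _) = + 0
δ (suc _) zero    = + 0
δ (suc j) (suc s) = δ j s

δ-diag : ∀ {n} (j : Fin n) → δ j j ≡ + 1
δ-diag zero    = refl
δ-diag (suc j) = δ-diag j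

δ-offDiag : ∀ {n} {j s : Fin n} → s ≢ j → δ j s ≡ + 0
δ-offDiag {j = zero}  {zero}  0≢0 = ⊥-elim (0≢0 refl)
δ-offDiag {j = zero}  {suc s} _   = refl
δ-offDiag {j = suc j} {zero}  _   = refl
δ-offDiag {j = suc j} {suc s} s≢j = δ-offDiag (s≢j ∘ cong suc)

detℤ-scalar : ∀ n d → detℤ {n} (λ j r → d ℤ.* δ j r) ≡ d ℤ.^ n
detℤ-scalar zero    d = refl
detℤ-scalar (suc n) d = begin
  d ℤ.* + 1 ℤ.* detℤ {n} (λ j r → d ℤ.* δ j r) ℤ.- ℤ-Determinant.alternatingSum offDiagonal
    ≡⟨ cong₂ (λ x y → d ℤ.* + 1 ℤ.* x ℤ.- y) (detℤ-scalar n d) offDiagonal≡0 ⟩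
  d ℤ.* + 1 ℤ.* d ℤ.^ n ℤ.- + 0
    ≡⟨ simplify d (d ℤ.^ n) ⟩
  d ℤ.^ suc n ∎
  where
  open ≡-Reasoning
  offDiagonal : Fin n → ℤ
  offDiagonal r = d ℤ.* + 0 ℤ.* detℤ (minor (suc r) (λ j r → d ℤ.* δ j r))
  offDiagonal≡0 : ℤ-Determinant.alternatingSum offDiagonal ≡ + 0
  offDiagonal≡0 = ι-injective (trans (ι-altSum offDiagonal) (altSum-0 {f = ι ∘ offDiagonal} λ r →
    cong ι (trans (cong (ℤ._* detℤ (minor (suc r) (λ j r → d ℤ.* δ j r))) (ℤ.*-zeroʳ d)) (ℤ.*-zeroˡ (detℤ (minor (suc r) (λ j r → d ℤ.* δ j r)))))))
  simplify : ∀ a x → a ℤ.* + 1 ℤ.* x ℤ.- + 0 ≡ a ℤ.* x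
  simplify = ℤ-Solver.solve-∀

-- Subgroups of ℤⁿ and lattices

record IsSubgroup {n} (P : Vecℤ n → Set) : Set where
  field
    0∈   : P (λ _ → + 0)
    +∈   : ∀ {u v} → P u → P v → P (λ r → u r ℤ.+ v r)
    -∈   : ∀ {u} → P u → P (λ r → ℤ.- u r)
    ∈-resp-≗ : ∀ {u v} → (∀ r → u r ≡ v r) → P u → P v

module _ {n} {P : Vecℤ n → Set} (P-subgroup : IsSubgroup P) where
  open IsSubgroup P-subgroup

  ℕ*∈ : ∀ k {u} → P u → P (λ r → + k ℤ.* u r)
  ℕ*∈ zero    {u} u∈ = ∈-resp-≗ (λ r → sym (ℤ.*-zeroˡ (u r))) 0∈
  ℕ*∈ (suc k) {u} u∈ = ∈-resp-≗ (λ r → sym (begin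
    + suc k ℤ.* u r               ≡⟨ cong (ℤ._* u r) (ℤ.pos-+ 1 k) ⟩
    (+ 1 ℤ.+ + k) ℤ.* u r         ≡⟨ ℤ.*-distribʳ-+ (u r) (+ 1) (+ k) ⟩
    + 1 ℤ.* u r ℤ.+ + k ℤ.* u r   ≡⟨ cong (ℤ._+ + k ℤ.* u r) (ℤ.*-identityˡ (u r)) ⟩
    u r ℤ.+ + k ℤ.* u r           ∎)) (+∈ u∈ (ℕ*∈ k u∈))
    where open ≡-Reasoning

  *∈ : ∀ k {u} → P u → P (λ r → k ℤ.* u r)
  *∈ (+ k)      u∈ = ℕ*∈ k u∈
  *∈ -[1+ k ] {u} u∈ = ∈-resp-≗ (λ r → ℤ.neg-distribˡ-* (+ suc k) (u r)) (-∈ (ℕ*∈ (suc k) u∈))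

  comb∈ : ∀ {k} (M : Mat n k) λs → (∀ j → P (M j)) → P (combℤ M λs)
  comb∈ {zero}  M λs M∈ = 0∈
  comb∈ {suc k} M λs M∈ = +∈ (*∈ (λs zero) (M∈ zero)) (comb∈ (M ∘ suc) (λs ∘ suc) (M∈ ∘ suc))

  𝓛-least : ∀ {k} (M : Mat n k) → (∀ j → P (M j)) → ∀ {v} → v ∈𝓛 M → P v
  𝓛-least M M∈ (λs , comb≡v) = ∈-resp-≗ comb≡v (comb∈ M λs M∈)

module _ {n k} (M : Mat n k) where

  combℤ-+ : ∀ a b r → combℤ M (λ j → a j ℤ.+ b j) r ≡ combℤ M a r ℤ.+ combℤ M b r
  combℤ-+ a b r = trans (ℤ-Sum.∑-cong (λ j → ℤ.*-distribʳ-+ (M j r) (a j) (b j))) (ℤ-Sum.∑-distrib-+ (λ j → a j ℤ.* M j r) (λ j → b j ℤ.* M j r))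

  combℤ-neg : ∀ a r → combℤ M (λ j → ℤ.- a j) r ≡ ℤ.- combℤ M a r
  combℤ-neg a r = trans (ℤ-Sum.∑-cong (λ j → sym (ℤ.neg-distribˡ-* (a j) (M j r)))) (ℤ-Sum.∑-distrib-neg (λ j → a j ℤ.* M j r))

  combℤ-0 : ∀ r → combℤ M (λ _ → + 0) r ≡ + 0
  combℤ-0 r = ℤ-Sum.∑-0# (λ j → ℤ.*-zeroˡ (M j r))

  ∈𝓛-isSubgroup : IsSubgroup (_∈𝓛 M)
  ∈𝓛-isSubgroup = record
    { 0∈       = (λ _ → + 0) , combℤ-0
    ; +∈       = λ (a , a≡u) (b , b≡v) → (λ j → a j ℤ.+ b j) , λ r → trans (combℤ-+ a b r) (cong₂ ℤ._+_ (a≡u r) (b≡v r))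
    ; -∈       = λ (a , a≡u) → (λ j → ℤ.- a j) , λ r → trans (combℤ-neg a r) (cong ℤ.-_ (a≡u r))
    ; ∈-resp-≗ = λ u≗v (a , a≡u) → a , λ r → trans (a≡u r) (u≗v r)
    }

  column∈𝓛 : ∀ i → M i ∈𝓛 M
  column∈𝓛 i = δ i , λ r → trans (ℤ-Sum.∑-δ i (λ j j≢i → trans (cong (ℤ._* M j r) (δ-offDiag j≢i)) (ℤ.*-zeroˡ (M j r))))
                                 (trans (cong (ℤ._* M i r) (δ-diag i)) (ℤ.*-identityˡ (M i r)))

-- Linear algebra over ℚ

record Dependency {k n} (v : Fin k → Vecℚ n) : Set where
  constructor dependency
  field
    coeff      : Fin k → ℚ
    nontrivial : ∃ λ j → coeff j ≢ 0ℚ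
    relation   : ∀ r → sumℚ (λ j → coeff j ℚ.* v j r) ≡ 0ℚ

eliminate : ∀ {k n} (v : Fin (suc k) → Vecℚ (suc n)) p → .{{ℚ.NonZero (v p zero)}} → Fin k → Vecℚ n
eliminate v p j r = v (punchIn p j) (suc r) ℚ.- (v (punchIn p j) zero ℚ.* ℚ.1/ v p zero) ℚ.* v p (suc r)

dependency-eliminate : ∀ {k n} (v : Fin (suc k) → Vecℚ (suc n)) p .{{_ : ℚ.NonZero (v p zero)}} →
  Dependency (eliminate v p) → Dependency v
dependency-eliminate {k} {n} v p (dependency μ (j₀ , μⱼ₀≢0) μ-relation) =
  dependency l (punchIn p j₀ , subst (_≢ 0ℚ) (sym (insertAt-punchIn μ p c j₀)) μⱼ₀≢0) relation
  where
  α = v p zero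
  open ≡-Reasoning
  S : ℚ
  S = sumℚ (λ j → μ j ℚ.* (v (punchIn p j) zero ℚ.* ℚ.1/ α))
  T : Fin (suc n) → ℚ
  T r = sumℚ (λ j → μ j ℚ.* v (punchIn p j) r)
  c = ℚ.- S
  l = insertAt μ p c
  split : ∀ r → sumℚ (λ j → l j ℚ.* v j r) ≡ c ℚ.* v p r ℚ.+ T r
  split r = trans (ℚ-Sum.∑-punchIn p (λ j → l j ℚ.* v j r))
    (cong₂ ℚ._+_ (cong (ℚ._* v p r) (insertAt-lookup μ p c))
                 (ℚ-Sum.∑-cong (λ j → cong (ℚ._* v (punchIn p j) r) (insertAt-punchIn μ p c j))))
  Sα≡T₀ : S ℚ.* α ≡ T zero
  Sα≡T₀ = trans (ℚ-Sum.*-distribʳ-∑ α (λ j → μ j ℚ.* (v (punchIn p j) zero ℚ.* ℚ.1/ α))) (ℚ-Sum.∑-cong λ j →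
    let x = v (punchIn p j) zero in
    trans (ℚ.*-assoc (μ j) (x ℚ.* ℚ.1/ α) α) (cong (μ j ℚ.*_) (trans (ℚ.*-assoc x (ℚ.1/ α) α)
      (trans (cong (x ℚ.*_) (ℚ.*-inverseˡ α)) (ℚ.*-identityʳ x)))))
  relation : ∀ r → sumℚ (λ j → l j ℚ.* v j r) ≡ 0ℚ
  relation zero = begin
    sumℚ (λ j → l j ℚ.* v j zero)   ≡⟨ split zero ⟩
    ℚ.- S ℚ.* α ℚ.+ T zero           ≡⟨ cong (ℚ._+ T zero) (sym (ℚ.neg-distribˡ-* S α)) ⟩
    ℚ.- (S ℚ.* α) ℚ.+ T zero         ≡⟨ cong (λ x → ℚ.- x ℚ.+ T zero) Sα≡T₀ ⟩
    ℚ.- T zero ℚ.+ T zero            ≡⟨ ℚ.+-inverseˡ (T zero) ⟩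
    0ℚ                               ∎
  relation (suc r) = begin
    sumℚ (λ j → l j ℚ.* v j (suc r))                         ≡⟨ split (suc r) ⟩
    ℚ.- S ℚ.* v p (suc r) ℚ.+ T (suc r)                       ≡⟨ solve 3 (λ s b t → (:- s) :* b :+ t := t :- s :* b) refl S (v p (suc r)) (T (suc r)) ⟩
    T (suc r) ℚ.- S ℚ.* v p (suc r)                           ≡⟨ cong (λ x → T (suc r) ℚ.- x) (ℚ-Sum.*-distribʳ-∑ (v p (suc r)) (λ j → μ j ℚ.* (v (punchIn p j) zero ℚ.* ℚ.1/ α))) ⟩
    T (suc r) ℚ.- sumℚ (λ j → μ j ℚ.* (v (punchIn p j) zero ℚ.* ℚ.1/ α) ℚ.* v p (suc r))
                                                             ≡⟨ ℚ-Sum.∑-distrib-- (λ j → μ j ℚ.* v (punchIn p j) (suc r)) (λ j → μ j ℚ.* (v (punchIn p j) zero ℚ.* ℚ.1/ α) ℚ.* v p (suc r)) ⟨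
    sumℚ (λ j → μ j ℚ.* v (punchIn p j) (suc r) ℚ.- μ j ℚ.* (v (punchIn p j) zero ℚ.* ℚ.1/ α) ℚ.* v p (suc r))
                                                             ≡⟨ ℚ-Sum.∑-cong (λ j → solve 4 (λ m a x b → m :* a :- m :* x :* b := m :* (a :- x :* b)) refl
                                                                  (μ j) (v (punchIn p j) (suc r)) (v (punchIn p j) zero ℚ.* ℚ.1/ α) (v p (suc r))) ⟩
    sumℚ (λ j → μ j ℚ.* (v (punchIn p j) (suc r) ℚ.- (v (punchIn p j) zero ℚ.* ℚ.1/ α) ℚ.* v p (suc r)))
                                                             ≡⟨ μ-relation r ⟩
    0ℚ                                                       ∎

dependent : ∀ {n k} → n < k → (v : Fin k → Vecℚ n) → Dependency v
dependent {zero}  {suc k} _ v = dependency (λ _ → 1ℚ) (zero , λ ()) (λ ())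
dependent {suc n} {suc k} (s≤s n<k) v with Fin.all? (λ p → v p zero ℚ.≟ 0ℚ)
... | yes firstRow≡0 = extend (dependent (ℕ.m<n⇒m<1+n n<k) (λ j r → v j (suc r)))
  where
  extend : Dependency (λ j r → v j (suc r)) → Dependency v
  extend (dependency l nontrivial rel) = dependency l nontrivial λ where
    zero    → ℚ-Sum.∑-0# (λ j → trans (cong (l j ℚ.*_) (firstRow≡0 j)) (ℚ.*-zeroʳ (l j)))
    (suc r) → rel r
... | no ¬firstRow≡0 =
  let p , α≢0 = Fin.¬∀⟶∃¬ (suc k) _ (λ p → v p zero ℚ.≟ 0ℚ) ¬firstRow≡0
      instance _ = ℚ.≢-nonZero α≢0
  in dependency-eliminate v p (dependent n<k _)

-- c, B 0, …, B (n - 1) are n + 1 vectors in ℚⁿ, hence dependent, and the coefficient of c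
-- cannot vanish because the columns of B are independent.
solvable : ∀ {n} (B : Mat n n) → LinIndep B → ∀ c → ∃ λ x → Solves B x c
solvable {n} B indep c with dependent (ℕ.n<1+n n) v
  where
  v : Fin (suc n) → Vecℚ n
  v zero    r = ι (c r)
  v (suc j) r = ι (B j r)
... | dependency l (j₀ , lⱼ₀≢0) rel with l zero ℚ.≟ 0ℚ
...   | yes l₀≡0 = ⊥-elim (lⱼ₀≢0 (l≡0 j₀))
  where
  B-relation : ∀ r → combℚ B (l ∘ suc) r ≡ 0ℚ
  B-relation r = begin
    combℚ B (l ∘ suc) r                            ≡⟨ ℚ.+-identityˡ _ ⟨
    0ℚ ℚ.+ combℚ B (l ∘ suc) r                     ≡⟨ cong (ℚ._+ combℚ B (l ∘ suc) r) (ℚ.*-zeroˡ (ι (c r))) ⟨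
    0ℚ ℚ.* ι (c r) ℚ.+ combℚ B (l ∘ suc) r         ≡⟨ cong (λ a → a ℚ.* ι (c r) ℚ.+ combℚ B (l ∘ suc) r) l₀≡0 ⟨
    l zero ℚ.* ι (c r) ℚ.+ combℚ B (l ∘ suc) r     ≡⟨ rel r ⟩
    0ℚ                                             ∎
    where open ≡-Reasoning
  l≡0 : ∀ j → l j ≡ 0ℚ
  l≡0 zero    = l₀≡0
  l≡0 (suc j) = indep (l ∘ suc) B-relation j
...   | no l₀≢0 = x , Bx≡c
  where
  instance _ = ℚ.≢-nonZero l₀≢0
  x : Vecℚ n
  x j = ℚ.- (l (suc j) ℚ.* ℚ.1/ l zero)
  Bl≡-l₀c : ∀ r → combℚ B (l ∘ suc) r ≡ ℚ.- (l zero ℚ.* ι (c r))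
  Bl≡-l₀c r = inverseˡ-unique (combℚ B (l ∘ suc) r) (l zero ℚ.* ι (c r))
    (trans (ℚ.+-comm (combℚ B (l ∘ suc) r) (l zero ℚ.* ι (c r))) (rel r))
  Bx≡c : Solves B x c
  Bx≡c r = begin
    combℚ B x r                                     ≡⟨ ℚ-Sum.∑-cong (λ j → solve 3 (λ a i b → (:- (a :* i)) :* b := (:- i) :* (a :* b)) refl (l (suc j)) (ℚ.1/ l zero) (ι (B j r))) ⟩
    sumℚ (λ j → ℚ.- ℚ.1/ l zero ℚ.* (l (suc j) ℚ.* ι (B j r)))
                                                    ≡⟨ ℚ-Sum.*-distribˡ-∑ (ℚ.- ℚ.1/ l zero) (λ j → l (suc j) ℚ.* ι (B j r)) ⟨
    ℚ.- ℚ.1/ l zero ℚ.* combℚ B (l ∘ suc) r         ≡⟨ cong (ℚ.- ℚ.1/ l zero ℚ.*_) (Bl≡-l₀c r) ⟩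
    ℚ.- ℚ.1/ l zero ℚ.* ℚ.- (l zero ℚ.* ι (c r))    ≡⟨ solve 3 (λ i a y → (:- i) :* (:- (a :* y)) := (a :* i) :* y) refl (ℚ.1/ l zero) (l zero) (ι (c r)) ⟩
    l zero ℚ.* ℚ.1/ l zero ℚ.* ι (c r)              ≡⟨ cong (ℚ._* ι (c r)) (ℚ.*-inverseʳ (l zero)) ⟩
    1ℚ ℚ.* ι (c r)                                  ≡⟨ ℚ.*-identityˡ (ι (c r)) ⟩
    ι (c r)                                         ∎
    where open ≡-Reasoning

ι-sum : ∀ {k} (f : Fin k → ℤ) → ι (sumℤ f) ≡ sumℚ (ι ∘ f)
ι-sum {zero}  f = refl
ι-sum {suc k} f = trans (ι-homo-+ (f zero) (sumℤ (f ∘ suc))) (cong (ι (f zero) ℚ.+_) (ι-sum (f ∘ suc)))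

ι-combℤ : ∀ {n k} (M : Mat n k) λs r → ι (combℤ M λs r) ≡ combℚ M (ι ∘ λs) r
ι-combℤ M λs r = trans (ι-sum (λ j → λs j ℤ.* M j r)) (ℚ-Sum.∑-cong (λ j → ι-homo-* (λs j) (M j r)))

combℚ-injective : ∀ {n k} (M : Mat n k) → LinIndep M → ∀ {x y} → (∀ r → combℚ M x r ≡ combℚ M y r) → ∀ j → x j ≡ y j
combℚ-injective M indep {x} {y} Mx≡My j = x∙y⁻¹≈ε⇒x≈y (x j) (y j) (indep (λ j → x j ℚ.- y j) (λ r → begin
  combℚ M (λ j → x j ℚ.- y j) r                  ≡⟨ ℚ-Sum.∑-cong (λ j → solve 3 (λ a b m → (a :- b) :* m := a :* m :- b :* m) refl (x j) (y j) (ι (M j r))) ⟩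
  sumℚ (λ j → x j ℚ.* ι (M j r) ℚ.- y j ℚ.* ι (M j r)) ≡⟨ ℚ-Sum.∑-distrib-- (λ j → x j ℚ.* ι (M j r)) (λ j → y j ℚ.* ι (M j r)) ⟩
  combℚ M x r ℚ.- combℚ M y r                    ≡⟨ cong (ℚ._- combℚ M y r) (Mx≡My r) ⟩
  combℚ M y r ℚ.- combℚ M y r                    ≡⟨ ℚ.+-inverseʳ (combℚ M y r) ⟩
  0ℚ                                             ∎) j)
  where open ≡-Reasoning

setCol-updates : ∀ {n} (B : Mat n n) i v → setCol B i v i ≡ v
setCol-updates B i v with i ≟ i
... | yes _   = refl
... | no  i≢i = ⊥-elim (i≢i refl)

setCol-minimal : ∀ {n} (B : Mat n n) i v {j} → j ≢ i → setCol B i v j ≡ B j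
setCol-minimal B i v {j} j≢i with j ≟ i
... | yes j≡i = ⊥-elim (j≢i j≡i)
... | no  _   = refl

-- If B y = c then the new solution is y - w z off i and w at i, where w = y i / z i.
solvable-setCol : ∀ {n} (B : Mat n n) i (z : Vecℚ n) v → z i ≢ 0ℚ → (∀ r → ι (v r) ≡ combℚ B z r) →
  (∀ c → ∃ λ x → Solves B x c) → ∀ c → ∃ λ x → Solves (setCol B i v) x c
solvable-setCol {suc n} B i z v zᵢ≢0 v≡Bz solvable c = x′ , B′x′≡c
  where
  open ≡-Reasoning
  instance _ = ℚ.≢-nonZero zᵢ≢0
  y = proj₁ (solvable c)
  w = y i ℚ.* ℚ.1/ z i
  u : Vecℚ (suc n)
  u j = y j ℚ.- w ℚ.* z j
  x′ = u [ i ]≔ w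
  B′ = setCol B i v
  rest : Mat (suc n) (suc n) → Vecℚ (suc n) → Vecℚ (suc n)
  rest M x r = sumℚ (λ j → x (punchIn i j) ℚ.* ι (M (punchIn i j) r))
  uᵢ≡0 : u i ≡ 0ℚ
  uᵢ≡0 = begin
    y i ℚ.- y i ℚ.* ℚ.1/ z i ℚ.* z i    ≡⟨ cong (λ a → y i ℚ.- a) (trans (ℚ.*-assoc (y i) (ℚ.1/ z i) (z i)) (cong (y i ℚ.*_) (ℚ.*-inverseˡ (z i)))) ⟩
    y i ℚ.- y i ℚ.* 1ℚ                 ≡⟨ cong (λ a → y i ℚ.- a) (ℚ.*-identityʳ (y i)) ⟩
    y i ℚ.- y i                        ≡⟨ ℚ.+-inverseʳ (y i) ⟩
    0ℚ                                 ∎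
  Bu≡c-wv : ∀ r → combℚ B u r ≡ ι (c r) ℚ.- w ℚ.* ι (v r)
  Bu≡c-wv r = begin
    combℚ B u r
      ≡⟨ ℚ-Sum.∑-cong (λ j → solve 4 (λ y w z b → (y :- w :* z) :* b := y :* b :- w :* (z :* b)) refl (y j) w (z j) (ι (B j r))) ⟩
    sumℚ (λ j → y j ℚ.* ι (B j r) ℚ.- w ℚ.* (z j ℚ.* ι (B j r)))
      ≡⟨ ℚ-Sum.∑-distrib-- (λ j → y j ℚ.* ι (B j r)) (λ j → w ℚ.* (z j ℚ.* ι (B j r))) ⟩
    combℚ B y r ℚ.- sumℚ (λ j → w ℚ.* (z j ℚ.* ι (B j r)))
      ≡⟨ cong₂ ℚ._-_ (proj₂ (solvable c) r) (trans (sym (ℚ-Sum.*-distribˡ-∑ w (λ j → z j ℚ.* ι (B j r)))) (cong (w ℚ.*_) (sym (v≡Bz r)))) ⟩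
    ι (c r) ℚ.- w ℚ.* ι (v r)
      ∎
  rest≡c-wv : ∀ r → rest B u r ≡ ι (c r) ℚ.- w ℚ.* ι (v r)
  rest≡c-wv r = begin
    rest B u r                                 ≡⟨ ℚ.+-identityˡ (rest B u r) ⟨
    0ℚ ℚ.+ rest B u r                          ≡⟨ cong (ℚ._+ rest B u r) (trans (sym (ℚ.*-zeroˡ (ι (B i r)))) (cong (ℚ._* ι (B i r)) (sym uᵢ≡0))) ⟩
    u i ℚ.* ι (B i r) ℚ.+ rest B u r           ≡⟨ ℚ-Sum.∑-punchIn i (λ j → u j ℚ.* ι (B j r)) ⟨
    combℚ B u r                                ≡⟨ Bu≡c-wv r ⟩
    ι (c r) ℚ.- w ℚ.* ι (v r)                  ∎
  B′x′≡c : Solves B′ x′ c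
  B′x′≡c r = begin
    combℚ B′ x′ r                              ≡⟨ ℚ-Sum.∑-punchIn i (λ j → x′ j ℚ.* ι (B′ j r)) ⟩
    x′ i ℚ.* ι (B′ i r) ℚ.+ rest B′ x′ r       ≡⟨ cong₂ ℚ._+_ (cong₂ (λ a col → a ℚ.* ι (col r)) ([]≔-updates u i w) (setCol-updates B i v))
                                                               (ℚ-Sum.∑-cong λ j → cong₂ (λ a col → a ℚ.* ι (col r))
                                                                  ([]≔-minimal u i w (punchInᵢ≢i i j)) (setCol-minimal B i v (punchInᵢ≢i i j))) ⟩
    w ℚ.* ι (v r) ℚ.+ rest B u r               ≡⟨ cong (w ℚ.* ι (v r) ℚ.+_) (rest≡c-wv r) ⟩
    w ℚ.* ι (v r) ℚ.+ (ι (c r) ℚ.- w ℚ.* ι (v r)) ≡⟨ solve 2 (λ a b → a :+ (b :- a) := b) refl (w ℚ.* ι (v r)) (ι (c r)) ⟩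
    ι (c r)                                    ∎

-- The algorithm

roundCoeffs-pivot : ∀ {n} (i : Fin n) x → roundCoeffs i x i ≡ nearest (x i)
roundCoeffs-pivot i x with i ≟ i
... | yes _   = refl
... | no  i≢i = ⊥-elim (i≢i refl)

setCol-elim : ∀ {n} (P : Fin n → Vecℤ n → Set) (B : Mat n n) i v → P i v → (∀ j → j ≢ i → P j (B j)) → ∀ j → P j (setCol B i v j)
setCol-elim P B i v Pᵢv PB j with j ≟ i
... | yes refl = Pᵢv
... | no  j≢i  = PB j j≢i

∏ : ∀ {k} → (Fin k → ℕ) → ℕ
∏ {zero}  f = 1
∏ {suc k} f = f zero ℕ.* ∏ (f ∘ suc)

∣∏ : ∀ {k} (f : Fin k → ℕ) i → f i ∣ ∏ f
∣∏ f zero    = ℕ.m∣m*n (∏ (f ∘ suc))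
∣∏ f (suc i) = ℕ.∣-trans (∣∏ (f ∘ suc) i) (ℕ.n∣m*n (f zero))

∏≢0 : ∀ {k} (f : Fin k → ℕ) → (∀ i → f i ≢ 0) → ∏ f ≢ 0
∏≢0 {zero}  f f≢0 ()
∏≢0 {suc k} f f≢0 ∏≡0 with ℕ.m*n≡0⇒m≡0∨n≡0 (f zero) ∏≡0
... | inj₁ f₀≡0 = f≢0 zero f₀≡0
... | inj₂ ∏≡0′ = ∏≢0 (f ∘ suc) (f≢0 ∘ suc) ∏≡0′

ℚ*-≢0 : ∀ {a b} → a ≢ 0ℚ → b ≢ 0ℚ → a ℚ.* b ≢ 0ℚ
ℚ*-≢0 {a} {b} a≢0 b≢0 ab≡0 = b≢0 (begin
  b                      ≡⟨ ℚ.*-identityˡ b ⟨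
  1ℚ ℚ.* b               ≡⟨ cong (ℚ._* b) (ℚ.*-inverseˡ a) ⟨
  ℚ.1/ a ℚ.* a ℚ.* b     ≡⟨ ℚ.*-assoc (ℚ.1/ a) a b ⟩
  ℚ.1/ a ℚ.* (a ℚ.* b)   ≡⟨ cong (ℚ.1/ a ℚ.*_) ab≡0 ⟩
  ℚ.1/ a ℚ.* 0ℚ          ≡⟨ ℚ.*-zeroʳ (ℚ.1/ a) ⟩
  0ℚ                     ∎)
  where
  open ≡-Reasoning
  instance _ = ℚ.≢-nonZero a≢0

module _ {A : Set} {P : A → Set} {c : A} {post : List A} where

  All-insert : ∀ pre → All P (pre ++ post) → P c → All P (pre ++ c ∷ post)
  All-insert pre Ppp Pc = ++⁺ (All.++⁻ˡ pre Ppp) (Pc ∷ All.++⁻ʳ pre Ppp)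

  All-delete : ∀ pre → All P (pre ++ c ∷ post) → All P (pre ++ post)
  All-delete pre Ppcp = ++⁺ (All.++⁻ˡ pre Ppcp) (All.tail (All.++⁻ʳ pre Ppcp))

  All-middle : ∀ pre → All P (pre ++ c ∷ post) → P c
  All-middle pre Ppcp = All.head (All.++⁻ʳ pre Ppcp)

module GeneralizedEuclid {n m} (A : Mat n m) (σ : Fin n → Fin m) (indep : LinIndep (λ i → A (σ i))) where

  B₀ : Mat n n
  B₀ i = A (σ i)

  coords : Fin m → Vecℚ n
  coords a = proj₁ (solvable B₀ indep (A a))

  B₀coords≡A : ∀ a → Solves B₀ (coords a) (A a)
  B₀coords≡A a = proj₂ (solvable B₀ indep (A a))

  D : ℕ
  D = ∏ λ a → ∏ λ k → ↧ₙ coords a k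

  D≢0 : D ≢ 0
  D≢0 = ∏≢0 _ λ a → ∏≢0 _ λ k → ℕ.≢-nonZero⁻¹ (↧ₙ coords a k)

  ↧∣D : ∀ a k → ↧ₙ coords a k ∣ D
  ↧∣D a k = ℕ.∣-trans (∣∏ (λ k → ↧ₙ coords a k) k) (∣∏ (λ a → ∏ λ k → ↧ₙ coords a k) a)

  Cleared : Vecℤ n → Set
  Cleared v = ∃ λ γ → ∀ r → combℤ B₀ γ r ≡ + D ℤ.* v r

  column-cleared : ∀ a → Cleared (A a)
  column-cleared a = γ , λ r → ι-injective (begin
    ι (combℤ B₀ γ r)                          ≡⟨ ι-combℤ B₀ γ r ⟩
    sumℚ (λ k → ι (γ k) ℚ.* ι (B₀ k r))       ≡⟨ ℚ-Sum.∑-cong (λ k → cong (ℚ._* ι (B₀ k r)) (ιγ≡Dcoords k)) ⟩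
    sumℚ (λ k → ι (+ D) ℚ.* coords a k ℚ.* ι (B₀ k r)) ≡⟨ ℚ-Sum.∑-cong (λ k → ℚ.*-assoc (ι (+ D)) (coords a k) (ι (B₀ k r))) ⟩
    sumℚ (λ k → ι (+ D) ℚ.* (coords a k ℚ.* ι (B₀ k r))) ≡⟨ ℚ-Sum.*-distribˡ-∑ (ι (+ D)) (λ k → coords a k ℚ.* ι (B₀ k r)) ⟨
    ι (+ D) ℚ.* combℚ B₀ (coords a) r         ≡⟨ cong (ι (+ D) ℚ.*_) (B₀coords≡A a r) ⟩
    ι (+ D) ℚ.* ι (A a r)                     ≡⟨ ι-homo-* (+ D) (A a r) ⟨
    ι (+ D ℤ.* A a r)                         ∎)
    where
    open ≡-Reasoning
    γ : Fin n → ℤ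
    γ k = + ℕ._∣_.quotient (↧∣D a k) ℤ.* ↥ coords a k
    ιγ≡Dcoords : ∀ k → ι (γ k) ≡ ι (+ D) ℚ.* coords a k
    ιγ≡Dcoords k = let e = ℕ._∣_.quotient (↧∣D a k); q = coords a k in begin
      ι (+ e ℤ.* ↥ q)                  ≡⟨ ι-homo-* (+ e) (↥ q) ⟩
      ι (+ e) ℚ.* ι (↥ q)              ≡⟨ cong (ι (+ e) ℚ.*_) (ι↧*q≡ι↥ q) ⟨
      ι (+ e) ℚ.* (ι (↧ q) ℚ.* q)      ≡⟨ ℚ.*-assoc (ι (+ e)) (ι (↧ q)) q ⟨
      ι (+ e) ℚ.* ι (↧ q) ℚ.* q        ≡⟨ cong (ℚ._* q) (ι-homo-* (+ e) (↧ q)) ⟨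
      ι (+ e ℤ.* ↧ q) ℚ.* q            ≡⟨ cong (λ d → ι d ℚ.* q) (trans (cong +_ (ℕ._∣_.equality (↧∣D a k))) (ℤ.pos-* e (↧ₙ q))) ⟨
      ι (+ D) ℚ.* q                    ∎

  cleared-isSubgroup : IsSubgroup Cleared
  cleared-isSubgroup = record
    { 0∈       = (λ _ → + 0) , λ r → trans (combℤ-0 B₀ r) (sym (ℤ.*-zeroʳ (+ D)))
    ; +∈       = λ {u} {v} (a , a≡u) (b , b≡v) → (λ j → a j ℤ.+ b j) , λ r →
                   trans (combℤ-+ B₀ a b r) (trans (cong₂ ℤ._+_ (a≡u r) (b≡v r)) (sym (ℤ.*-distribˡ-+ (+ D) (u r) (v r))))
    ; -∈       = λ {u} (a , a≡u) → (λ j → ℤ.- a j) , λ r →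
                   trans (combℤ-neg B₀ a r) (trans (cong ℤ.-_ (a≡u r)) (ℤ.neg-distribʳ-* (+ D) (u r)))
    ; ∈-resp-≗ = λ u≗v (a , a≡u) → a , λ r → trans (a≡u r) (cong (+ D ℤ.*_) (u≗v r))
    }

  ∈𝓛A⇒cleared : ∀ {v} → v ∈𝓛 A → Cleared v
  ∈𝓛A⇒cleared = 𝓛-least cleared-isSubgroup A column-cleared

  -- generates encodes 𝓛(A) ⊆ 𝓛(B ∪ C): every subgroup containing B and C contains the columns of A.
  record Invariant (B : Mat n n) (C : List (Vecℤ n)) : Set₁ where
    field
      generates  : ∀ {P} → IsSubgroup P → (∀ j → P (B j)) → All P C → ∀ a → P (A a)
      B⊆𝓛A       : ∀ j → B j ∈𝓛 A
      C⊆𝓛A       : All (_∈𝓛 A) C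
      invertible : ∀ c → ∃ λ x → Solves B x c
      S          : Mat n n
      B₀S≡DB     : ∀ j r → combℤ B₀ (S j) r ≡ + D ℤ.* B j r
      ∣detS∣≢0    : ℤ.∣ detℤ S ∣ ≢ 0

    measure : ℕ
    measure = ℤ.∣ detℤ S ∣

  open Invariant

  invariant⇒sameLattice : ∀ {B} → Invariant B [] → SameLattice B A
  invariant⇒sameLattice {B} I v = mk⇔
    (𝓛-least (∈𝓛-isSubgroup A) B (B⊆𝓛A I))
    (𝓛-least (∈𝓛-isSubgroup B) A (generates I (∈𝓛-isSubgroup B) (column∈𝓛 B) []))

  notChosen : ∀ a → Dec (¬ ∃ λ i → σ i ≡ a)
  notChosen a = ¬? (Fin.any? (λ i → σ i ≟ a))

  C₀ : List (Vecℤ n)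
  C₀ = map A (filter notChosen (allFin m))

  invariant₀ : Invariant B₀ C₀
  invariant₀ = record
    { generates  = generates₀
    ; B⊆𝓛A       = column∈𝓛 A ∘ σ
    ; C⊆𝓛A       = All.map⁺ (All.universal (column∈𝓛 A) _)
    ; invertible = solvable B₀ indep
    ; S          = S₀
    ; B₀S≡DB     = B₀S₀≡DB₀
    ; ∣detS∣≢0    = ∣detS₀∣≢0
    }
    where
    S₀ : Mat n n
    S₀ j r = + D ℤ.* δ j r
    B₀S₀≡DB₀ : ∀ j r → combℤ B₀ (S₀ j) r ≡ + D ℤ.* B₀ j r
    B₀S₀≡DB₀ j r = begin
      combℤ B₀ (S₀ j) r            ≡⟨ ℤ-Sum.∑-δ j (λ t t≢j → trans (cong (λ x → + D ℤ.* x ℤ.* B₀ t r) (δ-offDiag t≢j))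
                                                              (trans (cong (ℤ._* B₀ t r) (ℤ.*-zeroʳ (+ D))) (ℤ.*-zeroˡ (B₀ t r)))) ⟩
      + D ℤ.* δ j j ℤ.* B₀ j r     ≡⟨ cong (λ x → + D ℤ.* x ℤ.* B₀ j r) (δ-diag j) ⟩
      + D ℤ.* + 1 ℤ.* B₀ j r       ≡⟨ cong (ℤ._* B₀ j r) (ℤ.*-identityʳ (+ D)) ⟩
      + D ℤ.* B₀ j r               ∎
      where open ≡-Reasoning
    ∣detS₀∣≢0 : ℤ.∣ detℤ S₀ ∣ ≢ 0
    ∣detS₀∣≢0 ∣detS₀∣≡0 = D≢0 (ℤ.+-injective (ℤ.i^n≡0⇒i≡0 (+ D) n (trans (sym (detℤ-scalar n (+ D))) (ℤ.∣i∣≡0⇒i≡0 ∣detS₀∣≡0))))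
    generates₀ : ∀ {P} → IsSubgroup P → (∀ j → P (B₀ j)) → All P C₀ → ∀ a → P (A a)
    generates₀ {P} _ PB₀ PC₀ a with Fin.any? (λ i → σ i ≟ a)
    ... | yes (i , σi≡a) = subst P (cong A σi≡a) (PB₀ i)
    ... | no  a∉σ       = All.lookup PC₀ (∈-map⁺ A (∈-filter⁺ notChosen (∈-allFin a) a∉σ))

  invariant-remove : ∀ {B pre c post x} → Solves B x c → IsIntegral x → (I : Invariant B (pre ++ c ∷ post)) →
    Σ (Invariant B (pre ++ post)) λ I′ → measure I′ ≡ measure I
  invariant-remove {B} {pre} {c} {post} {x} Bx≡c integral I = record
    { generates  = λ P-subgroup PB PC → generates I P-subgroup PB (All-insert pre PC (𝓛-least P-subgroup B PB c∈𝓛B))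
    ; B⊆𝓛A       = B⊆𝓛A I
    ; C⊆𝓛A       = All-delete pre (C⊆𝓛A I)
    ; invertible = invertible I
    ; S          = S I
    ; B₀S≡DB     = B₀S≡DB I
    ; ∣detS∣≢0    = ∣detS∣≢0 I
    } , refl
    where
    κ : Fin n → ℤ
    κ j = proj₁ (integral j)
    c∈𝓛B : c ∈𝓛 B
    c∈𝓛B = κ , λ r → ι-injective (trans (ι-combℤ B κ r)
      (trans (ℚ-Sum.∑-cong (λ j → cong (ℚ._* ι (B j r)) (sym (proj₂ (integral j))))) (Bx≡c r)))

  module Exchange {B pre c post x i} (Bx≡c : Solves B x c) (frac≢0 : frac (x i) ≢ 0ℚ)
                  (I : Invariant B (pre ++ c ∷ post)) where
    open ≡-Reasoning

    κ : Fin n → ℤ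
    κ = roundCoeffs i x

    v : Vecℤ n
    v = newCol B i x c

    B′ : Mat n n
    B′ = setCol B i v

    z : Vecℚ n
    z j = x j ℚ.- ι (κ j)

    zᵢ≡x-⌈x⌋ : z i ≡ x i ℚ.- ι (nearest (x i))
    zᵢ≡x-⌈x⌋ = cong (λ k → x i ℚ.- ι k) (roundCoeffs-pivot i x)

    zᵢ≢0 : z i ≢ 0ℚ
    zᵢ≢0 = subst (_≢ 0ℚ) (sym zᵢ≡x-⌈x⌋) (q-⌈q⌋≢0 (x i) frac≢0)

    v≡Bz : ∀ r → ι (v r) ≡ combℚ B z r
    v≡Bz r = begin
      ι (c r ℤ.- combℤ B κ r)                    ≡⟨ ι-homo-- (c r) (combℤ B κ r) ⟩
      ι (c r) ℚ.- ι (combℤ B κ r)                ≡⟨ cong₂ ℚ._-_ (sym (Bx≡c r)) (ι-combℤ B κ r) ⟩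
      combℚ B x r ℚ.- combℚ B (ι ∘ κ) r          ≡⟨ ℚ-Sum.∑-distrib-- (λ j → x j ℚ.* ι (B j r)) (λ j → ι (κ j) ℚ.* ι (B j r)) ⟨
      sumℚ (λ j → x j ℚ.* ι (B j r) ℚ.- ι (κ j) ℚ.* ι (B j r))
                                                 ≡⟨ ℚ-Sum.∑-cong (λ j → solve 3 (λ a b m → a :* m :- b :* m := (a :- b) :* m) refl (x j) (ι (κ j)) (ι (B j r))) ⟩
      combℚ B z r                                ∎

    v+Bκ≡c : ∀ r → v r ℤ.+ combℤ B κ r ≡ c r
    v+Bκ≡c r = a-b+b≡a (c r) (combℤ B κ r)
      where
      a-b+b≡a : ∀ a b → a ℤ.- b ℤ.+ b ≡ a
      a-b+b≡a = ℤ-Solver.solve-∀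

    c∈𝓛A : c ∈𝓛 A
    c∈𝓛A = All-middle pre (C⊆𝓛A I)

    v∈𝓛A : v ∈𝓛 A
    v∈𝓛A = let open IsSubgroup (∈𝓛-isSubgroup A) in
      +∈ c∈𝓛A (-∈ (comb∈ (∈𝓛-isSubgroup A) B κ (B⊆𝓛A I)))

    generates′ : ∀ {P} → IsSubgroup P → (∀ j → P (B′ j)) → All P (B i ∷ (pre ++ post)) → ∀ a → P (A a)
    generates′ {P} P-subgroup PB′ (PBᵢ ∷ PC) = generates I P-subgroup PB (All-insert pre PC Pc)
      where
      open IsSubgroup P-subgroup
      PB : ∀ j → P (B j)
      PB j with j ≟ i
      ... | yes refl = PBᵢ
      ... | no  j≢i  = subst P (setCol-minimal B i v j≢i) (PB′ j)
      Pc : P c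
      Pc = ∈-resp-≗ v+Bκ≡c
             (+∈ (subst P (setCol-updates B i v) (PB′ i)) (comb∈ P-subgroup B κ PB))

    B′⊆𝓛A : ∀ j → B′ j ∈𝓛 A
    B′⊆𝓛A = setCol-elim (λ _ col → col ∈𝓛 A) B i v v∈𝓛A (λ j _ → B⊆𝓛A I j)

    v-cleared : Cleared v
    v-cleared = ∈𝓛A⇒cleared v∈𝓛A

    γ : Fin n → ℤ
    γ = proj₁ v-cleared

    S′ : Mat n n
    S′ = S I [ i ]≔ γ

    B₀S′≡DB′ : ∀ j r → combℤ B₀ (S′ j) r ≡ + D ℤ.* B′ j r
    B₀S′≡DB′ j r = setCol-elim (λ j col → combℤ B₀ (S′ j) r ≡ + D ℤ.* col r) B i v
      (trans (cong (λ col → combℤ B₀ col r) ([]≔-updates (S I) i γ)) (proj₂ v-cleared r))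
      (λ j j≢i → trans (cong (λ col → combℤ B₀ col r) ([]≔-minimal (S I) i γ j≢i)) (B₀S≡DB I j r)) j

    ιS : QMat n
    ιS j t = ι (S I j t)

    B₀γ≡B₀Sz : ∀ r → combℚ B₀ (ι ∘ γ) r ≡ combℚ B₀ (λ t → sumℚ (λ j → z j ℚ.* ιS j t)) r
    B₀γ≡B₀Sz r = begin
      combℚ B₀ (ι ∘ γ) r                                    ≡⟨ ι-combℤ B₀ γ r ⟨
      ι (combℤ B₀ γ r)                                      ≡⟨ cong ι (proj₂ v-cleared r) ⟩
      ι (+ D ℤ.* v r)                                       ≡⟨ ι-homo-* (+ D) (v r) ⟩
      ι (+ D) ℚ.* ι (v r)                                   ≡⟨ cong (ι (+ D) ℚ.*_) (v≡Bz r) ⟩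
      ι (+ D) ℚ.* combℚ B z r                               ≡⟨ ℚ-Sum.*-distribˡ-∑ (ι (+ D)) (λ j → z j ℚ.* ι (B j r)) ⟩
      sumℚ (λ j → ι (+ D) ℚ.* (z j ℚ.* ι (B j r)))          ≡⟨ ℚ-Sum.∑-cong (λ j → solve 3 (λ d a b → d :* (a :* b) := a :* (d :* b)) refl (ι (+ D)) (z j) (ι (B j r))) ⟩
      sumℚ (λ j → z j ℚ.* (ι (+ D) ℚ.* ι (B j r)))          ≡⟨ ℚ-Sum.∑-cong (λ j → cong (z j ℚ.*_) (DB≡B₀S j r)) ⟩
      sumℚ (λ j → z j ℚ.* sumℚ (λ t → a j t))               ≡⟨ ℚ-Sum.∑-cong (λ j → ℚ-Sum.*-distribˡ-∑ (z j) (a j)) ⟩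
      sumℚ (λ j → sumℚ (λ t → z j ℚ.* a j t))               ≡⟨ ℚ-Sum.∑-comm (λ j t → z j ℚ.* a j t) ⟩
      sumℚ (λ t → sumℚ (λ j → z j ℚ.* a j t))               ≡⟨ ℚ-Sum.∑-cong (λ t → ℚ-Sum.∑-cong (λ j → sym (ℚ.*-assoc (z j) (ιS j t) (ι (B₀ t r))))) ⟩
      sumℚ (λ t → sumℚ (λ j → z j ℚ.* ιS j t ℚ.* ι (B₀ t r))) ≡⟨ ℚ-Sum.∑-cong (λ t → ℚ-Sum.*-distribʳ-∑ (ι (B₀ t r)) (λ j → z j ℚ.* ιS j t)) ⟨
      combℚ B₀ (λ t → sumℚ (λ j → z j ℚ.* ιS j t)) r        ∎
      where
      a : Fin n → Fin n → ℚ
      a j t = ιS j t ℚ.* ι (B₀ t r)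
      DB≡B₀S : ∀ j r → ι (+ D) ℚ.* ι (B j r) ≡ combℚ B₀ (ιS j) r
      DB≡B₀S j r = trans (sym (ι-homo-* (+ D) (B j r))) (trans (cong ι (sym (B₀S≡DB I j r))) (ι-combℤ B₀ (S I j) r))

    γ≡Sz : ∀ t → ι (γ t) ≡ sumℚ (λ j → z j ℚ.* ιS j t)
    γ≡Sz = combℚ-injective B₀ indep B₀γ≡B₀Sz

    detS′≡zᵢdetS : ι (detℤ S′) ≡ z i ℚ.* ι (detℤ (S I))
    detS′≡zᵢdetS = begin
      ι (detℤ S′)                                          ≡⟨ ι-det S′ ⟩
      det (λ j t → ι (S′ j t))                             ≡⟨ det-cong (λ j t → cong (λ col → col t) ([]≔-map (S I) i (ι ∘_) γ j)) ⟩
      det (ιS [ i ]≔ (ι ∘ γ))                              ≡⟨ det-[]≔-cong ιS i γ≡Sz ⟩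
      det (ιS [ i ]≔ (λ t → sumℚ (λ j → z j ℚ.* ιS j t)))  ≡⟨ det-[]≔-comb ιS i z ⟩
      z i ℚ.* det ιS                                       ≡⟨ cong (z i ℚ.*_) (ι-det (S I)) ⟨
      z i ℚ.* ι (detℤ (S I))                               ∎

    ∣detS′∣≢0 : ℤ.∣ detℤ S′ ∣ ≢ 0
    ∣detS′∣≢0 ∣detS′∣≡0 = ℚ*-≢0 zᵢ≢0 ιdetS≢0 (trans (sym detS′≡zᵢdetS) (cong ι (ℤ.∣i∣≡0⇒i≡0 {detℤ S′} ∣detS′∣≡0)))
      where
      ιdetS≢0 : ι (detℤ (S I)) ≢ 0ℚ
      ιdetS≢0 ιdetS≡0 = ∣detS∣≢0 I (cong ℤ.∣_∣ (ι-injective {detℤ (S I)} {+ 0} ιdetS≡0))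

    invariant′ : Invariant B′ (B i ∷ (pre ++ post))
    invariant′ = record
      { generates  = generates′
      ; B⊆𝓛A       = B′⊆𝓛A
      ; C⊆𝓛A       = B⊆𝓛A I i ∷ All-delete pre (C⊆𝓛A I)
      ; invertible = solvable-setCol B i z v zᵢ≢0 v≡Bz (invertible I)
      ; S          = S′
      ; B₀S≡DB     = B₀S′≡DB′
      ; ∣detS∣≢0    = ∣detS′∣≢0
      }

    measure-decreases : measure invariant′ ℕ.< measure I
    measure-decreases = scale≤½⇒∣a∣<∣b∣ {detℤ S′} {detℤ (S I)} (z i) (subst (λ q → ℚ.∣ q ∣ ℚ.≤ ℚ.½) (sym zᵢ≡x-⌈x⌋) (∣q-⌈q⌋∣≤½ (x i)))
                                          detS′≡zᵢdetS (∣detS∣≢0 I)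

  step-exists : ∀ {B c rest} → Invariant B (c ∷ rest) → ∃ λ s′ → Step ⟨ B , c ∷ rest ⟩ s′
  step-exists {B} {c} {rest} I with invertible I c
  ... | x , Bx≡c with Fin.all? (λ j → frac (x j) ℚ.≟ 0ℚ)
  ...   | yes frac≡0 = _ , remove B [] c rest x Bx≡c (λ j → ⌊ x j ⌋ , frac≡0⇒q≡ι⌊q⌋ (x j) (frac≡0 j))
  ...   | no  ¬frac≡0 = let i , frac≢0 = Fin.¬∀⟶∃¬ n _ (λ j → frac (x j) ℚ.≟ 0ℚ) ¬frac≡0
                       in _ , exchange B [] c rest x i Bx≡c frac≢0

  Output : Mat n n → Set
  Output B = SameLattice B A

  -- Lexicographic induction on (|det S|, length C): an exchange shrinks |det S|,
  -- a removal keeps S and shortens C.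
  mutual
    terminates : ∀ d l {B C} (I : Invariant B C) → measure I ℕ.< d → length C ℕ.≤ l → AllRunsTerminate Output ⟨ B , C ⟩
    terminates d l {B} {[]}     I _   _     = done B (invariant⇒sameLattice I)
    terminates d l {B} {c ∷ cs} I m<d len≤l = step _ (λ ()) (step-exists I) λ _ st → continue d l st I m<d len≤l

    continue : ∀ d l {s s′} → Step s s′ → (I : Invariant (Bm s) (Cs s)) → measure I ℕ.< d → length (Cs s) ℕ.≤ l →
      AllRunsTerminate Output s′
    continue d zero (remove B pre c post x Bx≡c integral) I m<d len≤0 =
      ⊥-elim (ℕ.n≮0 (subst (ℕ._≤ 0) (List.length-++-sucʳ pre c post) len≤0))
    continue d (suc l) (remove B pre c post x Bx≡c integral) I m<d len≤l =
      let I′ , m′≡m = invariant-remove Bx≡c integral I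
      in terminates d l I′ (subst (ℕ._< d) (sym m′≡m) m<d) (ℕ.≤-pred (subst (ℕ._≤ suc l) (List.length-++-sucʳ pre c post) len≤l))
    continue (suc d) l (exchange B pre c post x i Bx≡c frac≢0) I m<d len≤l =
      terminates d l (Exchange.invariant′ Bx≡c frac≢0 I) (ℕ.<-≤-trans (Exchange.measure-decreases Bx≡c frac≢0 I) (ℕ.≤-pred m<d))
        (subst (ℕ._≤ l) (List.length-++-sucʳ pre c post) len≤l)

  allRunsTerminate : AllRunsTerminate Output ⟨ B₀ , C₀ ⟩
  allRunsTerminate = terminates (suc (measure invariant₀)) (length C₀) invariant₀ (ℕ.n<1+n _) ℕ.≤-refl

-- The rank hypothesis is already witnessed by σ and indep.
mainTheorem1 : (n m : ℕ) (A : Mat n m) → RankFull A →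
    (σ : Fin n → Fin m) → LinIndep (λ i → A (σ i)) →
    AllRunsTerminate (λ B → SameLattice B A) (initState A σ)
mainTheorem1 n m A _ σ indep = GeneralizedEuclid.allRunsTerminate A σ indep
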